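{- Every degenerate reflexible map is parallel-product indecomposable except the following, which are parallel-product decomposable: (1) $\mathrm{DM}_6(k)$, $\mathrm{DM}_7(k)$ and $\mathrm{DM}_8(k)$ for $k=2$ and for every $k>2$ that is not a prime power; (2) $\mathrm{DM}_9$, $\mathrm{DM}_{10}$, $\mathrm{DM}_{11}$ and $\mathrm{DM}_{12}$.
   Context: Let $F=\langle t,l,r\mid t^2=l^2=r^2=(tl)^2=1\rangle$. A (finite rooted) map is a quadruple $M=(f,G,Z,\mathrm{id})$, where $Z$ is a finite set of flags, $G=\mathrm{Mon}(M)$ is a group acting on $Z$ on the right, transitively and faithfully, $f:F\to G$ is an epimorphism, and $\mathrm{id}\in Z$ is the root; $T=f(t),L=f(l),R=f(r)$. Isomorphisms of maps are pairs $(\phi,\psi)$ of a group isomorphism $\psi$ compatible with the $f$'s and a root-preserving equivariant bijection $\phi$ of flags. An automorphism is a bijection $\alpha:Z\to Z$ with $\alpha(z\cdot g)=\alpha(z)\cdot g$; $M$ is reflexible if $\mathrm{Aut}(M)$ is regular on $Z$; a reflexible map is degenerate if one of $T,L,R,TL,TR,LR,TLR$ has order $1$. The maps $\mathrm{DM}_i$ are $(f,G,G,1)$ with $G=\langle T,L,R\mid T^{e_1},L^{e_2},R^{e_3},(TL)^{e_4},(TR)^{e_5},(LR)^{e_6},(TLR)^{e_7}\rangle$ acting on itself by right multiplication, where $(e_1,\dots,e_7)$ is: $\mathrm{DM}_1$ $(1,1,1,1,1,1,1)$; $\mathrm{DM}_2$ $(1,1,2,1,2,2,2)$; $\mathrm{DM}_3$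 $(2,1,1,2,2,1,2)$; $\mathrm{DM}_4$ $(1,2,1,2,1,2,2)$; $\mathrm{DM}_5$ $(2,2,1,1,2,2,1)$; $\mathrm{DM}_6(k)$ $(2,1,2,2,k,2,k)$; $\mathrm{DM}_7(k)$ $(1,2,2,2,2,k,k)$; $\mathrm{DM}_8(k)$ $(2,2,2,1,k,k,2)$ ($k>0$); $\mathrm{DM}_9$ $(2,2,1,2,2,2,2)$; $\mathrm{DM}_{10}$ $(2,2,2,2,1,2,2)$; $\mathrm{DM}_{11}$ $(2,2,2,2,2,1,2)$; $\mathrm{DM}_{12}$ $(2,2,2,2,2,2,1)$; up to isomorphism these are all degenerate reflexible maps. Parallel product: $M_1\parallel M_2=(f_{1,2},K,X,(\mathrm{id}_1,\mathrm{id}_2))$ with $f_{1,2}=(f_1,f_2)$, $K=f_{1,2}(F)$, $X$ the $K$-orbit of $(\mathrm{id}_1,\mathrm{id}_2)$. Monodromy quotient $M\triangle H=(q\circ f,G/H,Z/H,[\mathrm{id}])$ for $H\trianglelefteq G$. $M$ is parallel-product decomposable if $M\cong M_1\parallel M_2$ for maps $M_1,M_2$ each isomorphic to a monodromy quotient of $M$, with $M_1\parallel M_2$ isomorphic to neither $M_1$ nor $M_2$; otherwise indecomposable. -}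

module Defs where

open import Level using (Level; 0ℓ) renaming (suc to lsuc)
open import Data.Nat using (ℕ; zero; suc; _^_; _>_)
open import Data.Nat.Primality using (Prime)
open import Data.Fin using (Fin)
open import Data.List using (List; []; _∷_; _++_; reverse)
open import Data.Product using (Σ; ∃; ∃-syntax; _×_; _,_)
open import Data.Sum using (_⊎_)
open import Relation.Nullary using (¬_)
open import Relation.Binary.PropositionalEquality using (_≡_)
open import Function.Bundles using (_⇔_)

-- The group F = < t, l, r | t² = l² = r² = (tl)² = 1 >.
-- Elements of F are represented by words in the generators; since every
-- generator is an involution, the inverse of a word is its reverse.

data Gen : Set where
  t l r : Gen

Word : Set
Word = List Gen

_^ʷ_ : Word → ℕ → Word
w ^ʷ zero  = []
w ^ʷ suc k = w ++ (w ^ʷ k)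

act : ∀ {n} → (Gen → Fin n → Fin n) → Fin n → Word → Fin n
act g z []      = z
act g z (x ∷ w) = act g (g x z) w

-- A (finite rooted) map with n flags.  Since Mon(M) acts faithfully on
-- the flags, Mon(M) is (up to isomorphism) the permutation group of
-- Fin n generated by T, L, R, and f : F → Mon(M) sends a word to the
-- permutation it induces.  An element f(w) of Mon(M) is therefore
-- represented by the word w, two words being equal in Mon(M) iff they
-- act identically on all flags.

record Map (n : ℕ) : Set where
  field
    gen    : Gen → Fin n → Fin n
    root   : Fin n
    -- f is a homomorphism from F: the defining relations hold
    t²     : ∀ z → act gen z (t ∷ t ∷ []) ≡ z
    l²     : ∀ z → act gen z (l ∷ l ∷ []) ≡ z
    r²     : ∀ z → act gen z (r ∷ r ∷ []) ≡ z
    tl²    : ∀ z → act gen z (t ∷ l ∷ t ∷ l ∷ []) ≡ z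
    transitive : ∀ z → ∃[ w ] act gen root w ≡ z

open Map public

module _ {n : ℕ} (M : Map n) where

  _·_ : Fin n → Word → Fin n
  z · w = act (gen M) z w

  Trivial : Word → Set
  Trivial w = ∀ z → z · w ≡ z

  _≈G_ : Word → Word → Set
  u ≈G v = ∀ z → z · u ≡ z · v

  IsAut : (Fin n → Fin n) → Set
  IsAut α = (∀ z z' → α z ≡ α z' → z ≡ z')
          × (∀ z' → ∃[ z ] α z ≡ z')
          × (∀ z w → α (z · w) ≡ (α z) · w)

  Reflexible : Set
  Reflexible = (∀ z z' → ∃[ α ] (IsAut α × α z ≡ z'))
             × (∀ α β → IsAut α → IsAut β → ∀ z → α z ≡ β z → ∀ y → α y ≡ β y)

  Degenerate : Set
  Degenerate = Trivial (t ∷ []) ⊎ Trivial (l ∷ []) ⊎ Trivial (r ∷ [])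
             ⊎ Trivial (t ∷ l ∷ []) ⊎ Trivial (t ∷ r ∷ []) ⊎ Trivial (l ∷ r ∷ [])
             ⊎ Trivial (t ∷ l ∷ r ∷ [])

  -- a normal subgroup H of Mon(M), given as a predicate on words that
  -- only depends on the element of Mon(M) represented
  record NormalSubgroup : Set₁ where
    field
      mem      : Word → Set
      resp     : ∀ {u v} → u ≈G v → mem u → mem v
      has-id   : mem []
      closed-∙ : ∀ {u v} → mem u → mem v → mem (u ++ v)
      closed-⁻¹ : ∀ {u} → mem u → mem (reverse u)
      normal   : ∀ {u} → mem u → ∀ g → mem (reverse g ++ u ++ g)

  open NormalSubgroup public

  -- IsoQuot M' H  means  M' ≅ M △ H.  The flags of M △ H are the H-orbits on the flags of M,
  -- its monodromy group is Mon(M)/H.  An isomorphism (φ, ψ) is encoded by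
  -- π = φ ∘ (projection to orbits):
  --   * φ is well defined and injective: π z ≡ π z' iff z, z' lie in the
  --     same H-orbit;
  --   * φ is surjective, root preserving and equivariant;
  --   * ψ : Mon(M)/H → Mon(M'), ψ(f(w)H) = f'(w), is a well-defined group
  --     isomorphism: f'(w) = 1 iff f(w) ∈ H.
  IsoQuot : ∀ {n'} → Map n' → NormalSubgroup → Set
  IsoQuot {n'} M' H = Σ (Fin n → Fin n') λ π →
      ( (π (root M) ≡ root M')
      × (∀ z x → π (gen M x z) ≡ gen M' x (π z))
      × (∀ z z' → (π z ≡ π z') ⇔ (∃[ h ] (mem H h × z · h ≡ z')))
      × (∀ z' → ∃[ z ] π z ≡ z')
      × (∀ w → Trivial' w ⇔ mem H w) )
    where
      Trivial' : Word → Set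
      Trivial' w = ∀ z' → act (gen M') z' w ≡ z'

  QuotientOf : ∀ {n'} → Map n' → Set₁
  QuotientOf M' = ∃[ H ] IsoQuot M' H

-- M ≅ M₁ ∥ M₂.  The flags of M₁ ∥ M₂ form the orbit X of (id₁, id₂) under
-- the diagonal action of K = f₁,₂(F) ≤ Mon(M₁) × Mon(M₂).  An isomorphism
-- consists of a root-preserving equivariant bijection φ : Z → X and a
-- group isomorphism ψ : Mon(M) → K with ψ(f(w)) = (f₁(w), f₂(w)), which is
-- well defined and bijective iff f(w) = 1 ⇔ (f₁(w) = 1 and f₂(w) = 1).
IsoPar : ∀ {n n₁ n₂} → Map n → Map n₁ → Map n₂ → Set
IsoPar {n} {n₁} {n₂} M M₁ M₂ =
  Σ (Fin n → Fin n₁ × Fin n₂) λ φ →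
      (φ (root M) ≡ (root M₁ , root M₂))
    × (∀ z x → φ (gen M x z) ≡ (let (a , b) = φ z in (gen M₁ x a , gen M₂ x b)))
    × (∀ z z' → φ z ≡ φ z' → z ≡ z')
    × (∀ z → ∃[ w ] φ z ≡ (act (gen M₁) (root M₁) w , act (gen M₂) (root M₂) w))
    × (∀ w → ∃[ z ] φ z ≡ (act (gen M₁) (root M₁) w , act (gen M₂) (root M₂) w))
    × (∀ w → Trivial M w ⇔ (Trivial M₁ w × Trivial M₂ w))

Decomposable : ∀ {n} → Map n → Set₁
Decomposable M =
  ∃[ n₁ ] ∃[ n₂ ] Σ (Map n₁) λ M₁ → Σ (Map n₂) λ M₂ →
      QuotientOf M M₁ × QuotientOf M M₂
    × IsoPar M M₁ M₂
    × ¬ IsoPar M₁ M₁ M₂      -- M₁ ∥ M₂ ≇ M₁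
    × ¬ IsoPar M₂ M₁ M₂      -- M₁ ∥ M₂ ≇ M₂

Indecomposable : ∀ {n} → Map n → Set₁
Indecomposable M = ¬ Decomposable M

-- The maps DM_i: the group
--   G = < T,L,R | T^e₁, L^e₂, R^e₃, (TL)^e₄, (TR)^e₅, (LR)^e₆, (TLR)^e₇ >
-- (which, being generated by the images of t, l, r subject also to the
-- relations of F, is F modulo the congruence below) acting on itself by
-- right multiplication, with root 1.

record Exps : Set where
  constructor exps
  field e₁ e₂ e₃ e₄ e₅ e₆ e₇ : ℕ

data _≈⟨_⟩_ : Word → Exps → Word → Set where
  ≈refl  : ∀ {e u} → u ≈⟨ e ⟩ u
  ≈sym   : ∀ {e u v} → u ≈⟨ e ⟩ v → v ≈⟨ e ⟩ u
  ≈trans : ∀ {e u v w} → u ≈⟨ e ⟩ v → v ≈⟨ e ⟩ w → u ≈⟨ e ⟩ w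
  ≈cong  : ∀ {e u u' v v'} → u ≈⟨ e ⟩ u' → v ≈⟨ e ⟩ v' → (u ++ v) ≈⟨ e ⟩ (u' ++ v')
  rel-t² : ∀ {e} → (t ∷ t ∷ []) ≈⟨ e ⟩ []
  rel-l² : ∀ {e} → (l ∷ l ∷ []) ≈⟨ e ⟩ []
  rel-r² : ∀ {e} → (r ∷ r ∷ []) ≈⟨ e ⟩ []
  rel-tl² : ∀ {e} → (t ∷ l ∷ t ∷ l ∷ []) ≈⟨ e ⟩ []
  rel₁ : ∀ {e} → ((t ∷ []) ^ʷ Exps.e₁ e) ≈⟨ e ⟩ []
  rel₂ : ∀ {e} → ((l ∷ []) ^ʷ Exps.e₂ e) ≈⟨ e ⟩ []
  rel₃ : ∀ {e} → ((r ∷ []) ^ʷ Exps.e₃ e) ≈⟨ e ⟩ []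
  rel₄ : ∀ {e} → ((t ∷ l ∷ []) ^ʷ Exps.e₄ e) ≈⟨ e ⟩ []
  rel₅ : ∀ {e} → ((t ∷ r ∷ []) ^ʷ Exps.e₅ e) ≈⟨ e ⟩ []
  rel₆ : ∀ {e} → ((l ∷ r ∷ []) ^ʷ Exps.e₆ e) ≈⟨ e ⟩ []
  rel₇ : ∀ {e} → ((t ∷ l ∷ r ∷ []) ^ʷ Exps.e₇ e) ≈⟨ e ⟩ []

-- M ≅ DM(e): an isomorphism (φ, ψ) with DM(e) = (f, G, G, 1).
--   φ : Z → G is determined by root-preservation and equivariance,
--   φ(id · w) = [w]; it is well defined and injective iff
--   id · u = id · v ⇔ [u] = [v] (surjectivity is automatic).
--   ψ : Mon(M) → G, ψ(f_M(w)) = [w], is a well-defined isomorphism iff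
--   f_M(w) = 1 ⇔ [w] = 1.
IsoDM : ∀ {n} → Exps → Map n → Set
IsoDM e M =
    (∀ u v → (_·_ M (root M) u ≡ _·_ M (root M) v) ⇔ (u ≈⟨ e ⟩ v))
  × (∀ w → Trivial M w ⇔ (w ≈⟨ e ⟩ []))

DM₁ DM₂ DM₃ DM₄ DM₅ DM₉ DM₁₀ DM₁₁ DM₁₂ : Exps
DM₁  = exps 1 1 1 1 1 1 1
DM₂  = exps 1 1 2 1 2 2 2
DM₃  = exps 2 1 1 2 2 1 2
DM₄  = exps 1 2 1 2 1 2 2
DM₅  = exps 2 2 1 1 2 2 1
DM₉  = exps 2 2 1 2 2 2 2
DM₁₀ = exps 2 2 2 2 1 2 2
DM₁₁ = exps 2 2 2 2 2 1 2
DM₁₂ = exps 2 2 2 2 2 2 1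

DM₆ DM₇ DM₈ : ℕ → Exps
DM₆ k = exps 2 1 2 2 k 2 k
DM₇ k = exps 1 2 2 2 2 k k
DM₈ k = exps 2 2 2 1 k k 2

PrimePower : ℕ → Set
PrimePower k = ∃[ p ] ∃[ m ] (Prime p × k ≡ p ^ m)

Exceptional : ∀ {n} → Map n → Set
Exceptional M =
    (∃[ k ] ((k ≡ 2 ⊎ (k > 2 × ¬ PrimePower k))
             × (IsoDM (DM₆ k) M ⊎ IsoDM (DM₇ k) M ⊎ IsoDM (DM₈ k) M)))
  ⊎ IsoDM DM₉ M ⊎ IsoDM DM₁₀ M ⊎ IsoDM DM₁₁ M ⊎ IsoDM DM₁₂ M

-- A parallel-product decomposition M ≅ M₁ ∥ M₂ by two monodromy quotients gives two normal
-- subgroups of Mon(M), the kernels of M → Mᵢ, which intersect trivially; neither is trivial, as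
-- otherwise M₁ ∥ M₂ ≅ Mᵢ.  So M is indecomposable as soon as Mon(M) is monolithic.
--
-- If M is degenerate, one of T, L, R, TL, TR, LR, TLR is trivial, so Mon(M) is generated by two
-- involutions a and b and is dihedral of order 2k, k the order of ρ = ab; when the trivial word
-- is R, TR, LR or TLR we may take ρ = TL, so k ≤ 2.  Normal forms ρ^i a^s (i < k) show that a
-- reflexible M with k ≥ 2 is isomorphic to the corresponding DM_i(k).  If Mon(M) has at most
-- two elements, or k = p^(1+m) > 2, Mon(M) is monolithic (every nontrivial normal subgroup
-- contains ρ^(p^m)).  Conversely the Klein four-group (k = 2) is the parallel product of two of
-- its quotients of order 2, and for k = m₁ m₂ with coprime m₁, m₂ > 1 the dihedral group of
-- order 2k is the parallel product of its quotients of orders 2m₁ and 2m₂ (Chinese remainder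
-- theorem); each quotient is realised as an explicit map on 2m flags.

module Submission where

open import Data.Nat
open import Data.Nat.Properties
open import Data.Nat.Divisibility
open import Data.Nat.DivMod
open import Data.Nat.Primality using (Prime; prime⇒irreducible; prime⇒nonZero; prime⇒nonTrivial)
open import Data.Nat.Coprimality as Coprimality using (Coprime; coprime-divisor)
open import Data.Nat.GCD using (gcd; gcd-GCD; gcd[m,n]∣m; gcd[m,n]∣n; module Bézout)
open import Data.Nat.LCM using (lcm; lcm-least; gcd*lcm)
open import Data.Nat.Induction using (<-wellFounded)
open import Data.Nat.Primality.Factorisation using (factorise; PrimeFactorisation)
open import Data.Nat.ListAction using (product)
open import Data.Nat.Tactic.RingSolver using (solve-∀)
open import Data.Bool using (Bool; true; false; not; _xor_; if_then_else_)
open import Data.Bool.Properties using (xor-assoc; xor-same)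
open import Data.Fin using (Fin; toℕ; join; splitAt)
import Data.Fin.Properties as Fin
open import Data.List using (List; []; _∷_; _++_; [_]; reverse; map; foldl; concatMap)
open import Data.List.Properties using (++-assoc; ++-identityʳ; unfold-reverse; reverse-involutive; map-++; foldl-++)
open import Data.List.Relation.Unary.All using (All; []; _∷_)
open import Data.Product using (∃-syntax; _×_; _,_; proj₁; proj₂)
open import Data.Sum as Sum using (_⊎_; inj₁; inj₂; [_,_]′)
open import Data.Unit using (⊤; tt)
open import Data.Empty using (⊥; ⊥-elim)
open import Function.Base using (_∘_)
open import Function.Bundles using (_⇔_; mk⇔; Equivalence)
open import Induction.WellFounded using (Acc; acc)
open import Relation.Nullary using (¬_; Dec; yes; no; contradiction)
open import Relation.Nullary.Decidable using (decidable-stable; _×-dec_)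
open import Relation.Unary using (Decidable)
open import Relation.Binary.PropositionalEquality hiding ([_]; resp)
import Relation.Binary.Reasoning.Base.Single as SingleReasoning

open import Defs

open Equivalence

-- Arithmetic

prime∤⇒coprime : ∀ {p d} → Prime p → ¬ p ∣ d → Coprime p d
prime∤⇒coprime p-prime p∤d (c∣p , c∣d) with prime⇒irreducible p-prime c∣p
... | inj₁ c≡1 = c≡1
... | inj₂ refl = contradiction c∣d p∤d

m∣p^[1+n]∧m<p^[1+n]⇒m∣p^n : ∀ {p m} → Prime p → ∀ n →
  m ∣ p ^ suc n → m < p ^ suc n → m ∣ p ^ n
m∣p^[1+n]∧m<p^[1+n]⇒m∣p^n {p} {m} p-prime n m∣ m< with p ∣? m
... | no p∤m = coprime-divisor (Coprimality.sym (prime∤⇒coprime p-prime p∤m)) m∣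
... | yes (divides-refl q) = lift n q∣p^n q<p^n
  where
  instance _ = prime⇒nonZero p-prime
  q∣p^n : q ∣ p ^ n
  q∣p^n = *-cancelʳ-∣ p (subst (q * p ∣_) (*-comm p (p ^ n)) m∣)
  q<p^n : q < p ^ n
  q<p^n = *-cancelʳ-< p q (p ^ n) (subst (q * p <_) (*-comm p (p ^ n)) m<)
  lift : ∀ n → q ∣ p ^ n → q < p ^ n → q * p ∣ p ^ n
  lift zero q∣1 (s≤s z≤n) = contradiction (0∣⇒≡0 q∣1) λ ()
  lift (suc n) q∣ q< = subst (q * p ∣_) (*-comm (p ^ n) p)
    (*-monoˡ-∣ p (m∣p^[1+n]∧m<p^[1+n]⇒m∣p^n p-prime n q∣ q<))

coprime∧∣∧∣⇒*∣ : ∀ {m n i} → Coprime m n → m ∣ i → n ∣ i → m * n ∣ i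
coprime∧∣∧∣⇒*∣ {m} {n} m⊥n m∣i n∣i = subst (_∣ _) lcm≡m*n (lcm-least m∣i n∣i)
  where
  lcm≡m*n : lcm m n ≡ m * n
  lcm≡m*n = begin
    lcm m n           ≡⟨ *-identityˡ (lcm m n) ⟨
    1 * lcm m n       ≡⟨ cong (_* lcm m n) (Coprimality.coprime⇒gcd≡1 m⊥n) ⟨
    gcd m n * lcm m n ≡⟨ gcd*lcm m n ⟩
    m * n             ∎
    where open ≡-Reasoning

coprime∧∣∧∣∧<*⇒≡0 : ∀ {m n i} → Coprime m n → m ∣ i → n ∣ i → i < m * n → i ≡ 0
coprime∧∣∧∣∧<*⇒≡0 {i = zero} _ _ _ _ = refl
coprime∧∣∧∣∧<*⇒≡0 {i = suc _} m⊥n m∣i n∣i i< =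
  contradiction (∣⇒≤ (coprime∧∣∧∣⇒*∣ m⊥n m∣i n∣i)) (<⇒≱ i<)

coprime∧1<⇒∤ : ∀ {m n} → Coprime m n → 1 < n → ¬ n ∣ m
coprime∧1<⇒∤ m⊥n 1<n n∣m = <⇒≢ 1<n (sym (m⊥n (n∣m , ∣-refl)))

prime>1 : ∀ {p} → Prime p → 1 < p
prime>1 {p} p-prime = nonTrivial⇒n>1 p {{prime⇒nonTrivial p-prime}}

∃prime∣ : ∀ k → 1 < k → ∃[ p ] (Prime p × p ∣ k)
∃prime∣ k 1<k = first-factor (PrimeFactorisation.isFactorisation f) (PrimeFactorisation.factorsPrime f)
  where
  instance _ = >-nonZero (<-trans z<s 1<k)
  f = factorise k
  first-factor : ∀ {ps} → k ≡ product ps → All Prime ps → ∃[ p ] (Prime p × p ∣ k)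
  first-factor {[]} k≡1 [] = contradiction k≡1 (>⇒≢ 1<k)
  first-factor {p ∷ ps} k≡ (p-prime ∷ _) = p , p-prime , divides (product ps) (trans k≡ (*-comm p (product ps)))

p-part : ∀ {p} → Prime p → ∀ k → 0 < k → ∃[ m ] ∃[ c ] (k ≡ p ^ m * c × ¬ p ∣ c)
p-part {p} p-prime k 0<k = go k 0<k (<-wellFounded k)
  where
  go : ∀ k → 0 < k → Acc _<_ k → ∃[ m ] ∃[ c ] (k ≡ p ^ m * c × ¬ p ∣ c)
  go k 0<k (acc rec) with p ∣? k
  ... | no p∤k = 0 , k , sym (*-identityˡ k) , p∤k
  go .(suc q * p) 0<k (acc rec) | yes (divides-refl (suc q))
    with go (suc q) z<s (rec (m<m*n (suc q) p (prime>1 p-prime)))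
  ... | m , c , q≡ , p∤c = suc m , c , eq , p∤c
    where
    eq : suc q * p ≡ p * p ^ m * c
    eq = begin
      suc q * p       ≡⟨ cong (_* p) q≡ ⟩
      p ^ m * c * p   ≡⟨ *-comm (p ^ m * c) p ⟩
      p * (p ^ m * c) ≡⟨ *-assoc p (p ^ m) c ⟨
      p * p ^ m * c   ∎
      where open ≡-Reasoning

coprime-^ˡ : ∀ {p c} → Coprime p c → ∀ m → Coprime (p ^ m) c
coprime-^ˡ _ zero (d∣1 , _) = ∣1⇒≡1 d∣1
coprime-^ˡ {p} {c} p⊥c (suc m) {d} (d∣p*p^m , d∣c) =
  coprime-^ˡ p⊥c m (coprime-divisor {o = p ^ m} d⊥p d∣p*p^m , d∣c)
  where
  d⊥p : Coprime d p
  d⊥p (e∣d , e∣p) = p⊥c (e∣p , ∣-trans e∣d d∣c)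

¬primePower⇒coprime-split : ∀ k → 2 < k → ¬ PrimePower k →
  ∃[ m ] ∃[ n ] (1 < m × 1 < n × Coprime m n × k ≡ m * n)
¬primePower⇒coprime-split k 2<k ¬pp with ∃prime∣ k (<-trans (s<s z<s) 2<k)
... | p , p-prime , p∣k with p-part p-prime k (<-trans z<s 2<k)
... | m , c , k≡ , p∤c = split m c k≡ p∤c
  where
  instance _ = prime⇒nonZero p-prime
  split : ∀ m c → k ≡ p ^ m * c → ¬ p ∣ c →
    ∃[ m ] ∃[ n ] (1 < m × 1 < n × Coprime m n × k ≡ m * n)
  split m 0 _ p∤0 = contradiction (p ∣0) p∤0
  split m 1 k≡ _ = contradiction (p , m , p-prime , trans k≡ (*-identityʳ (p ^ m))) ¬pp
  split 0 (suc (suc c)) k≡ p∤c = contradiction (subst (p ∣_) (trans k≡ (+-identityʳ _)) p∣k) p∤c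
  split (suc m) c@(suc (suc _)) k≡ p∤c =
    p ^ suc m , c , ^-monoʳ-< p (prime>1 p-prime) {0} {suc m} z<s , s<s z<s ,
    coprime-^ˡ (prime∤⇒coprime p-prime p∤c) (suc m) , k≡

-- Quotients of F

act-++ : ∀ {n} (g : Gen → Fin n → Fin n) z u v → act g z (u ++ v) ≡ act g (act g z u) v
act-++ g z [] v = refl
act-++ g z (x ∷ u) v = act-++ g (g x z) u v

^ʷ-+ : ∀ w i j → w ^ʷ (i + j) ≡ (w ^ʷ i) ++ (w ^ʷ j)
^ʷ-+ w zero j = refl
^ʷ-+ w (suc i) j = trans (cong (w ++_) (^ʷ-+ w i j)) (sym (++-assoc w (w ^ʷ i) (w ^ʷ j)))

^ʷ-suc : ∀ w j → w ^ʷ suc j ≡ (w ^ʷ j) ++ w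
^ʷ-suc w zero = ++-identityʳ w
^ʷ-suc w (suc j) = trans (cong (w ++_) (^ʷ-suc w j)) (sym (++-assoc w (w ^ʷ j) w))

^ʷ-* : ∀ w i j → w ^ʷ (j * i) ≡ (w ^ʷ i) ^ʷ j
^ʷ-* w i zero = refl
^ʷ-* w i (suc j) = trans (^ʷ-+ w i (j * i)) (cong ((w ^ʷ i) ++_) (^ʷ-* w i j))

-- A congruence on words containing the defining relations of F, i.e. a quotient of F.
record FCongruence : Set₁ where
  infix 4 _∼_
  field
    _∼_     : Word → Word → Set
    ∼-refl  : ∀ {u} → u ∼ u
    ∼-sym   : ∀ {u v} → u ∼ v → v ∼ u
    ∼-trans : ∀ {u v w} → u ∼ v → v ∼ w → u ∼ w
    ++-cong : ∀ {u u' v v'} → u ∼ u' → v ∼ v' → u ++ v ∼ u' ++ v'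
    x²∼ε    : ∀ x → x ∷ x ∷ [] ∼ []
    [tl]²∼ε : t ∷ l ∷ t ∷ l ∷ [] ∼ []

  module ∼-Reasoning = SingleReasoning _∼_ ∼-refl ∼-trans

  ≡⇒∼ : ∀ {u v} → u ≡ v → u ∼ v
  ≡⇒∼ refl = ∼-refl

  ++-congˡ : ∀ u {v v'} → v ∼ v' → u ++ v ∼ u ++ v'
  ++-congˡ u = ++-cong ∼-refl

  ++-congʳ : ∀ {u u'} v → u ∼ u' → u ++ v ∼ u' ++ v
  ++-congʳ v p = ++-cong p ∼-refl

  reverse-inverseʳ : ∀ u → u ++ reverse u ∼ []
  reverse-inverseʳ [] = ∼-refl
  reverse-inverseʳ (x ∷ u) = begin
    x ∷ u ++ reverse (x ∷ u)   ≡⟨ cong (λ v → x ∷ u ++ v) (unfold-reverse x u) ⟩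
    x ∷ u ++ reverse u ++ [ x ] ≡⟨ cong (x ∷_) (++-assoc u (reverse u) [ x ]) ⟨
    [ x ] ++ (u ++ reverse u) ++ [ x ] ∼⟨ ++-congˡ [ x ] (++-congʳ [ x ] (reverse-inverseʳ u)) ⟩
    x ∷ x ∷ []                  ∼⟨ x²∼ε x ⟩
    []                          ∎
    where open ∼-Reasoning

  reverse-inverseˡ : ∀ u → reverse u ++ u ∼ []
  reverse-inverseˡ u = begin
    reverse u ++ u                   ≡⟨ cong (reverse u ++_) (reverse-involutive u) ⟨
    reverse u ++ reverse (reverse u) ∼⟨ reverse-inverseʳ (reverse u) ⟩
    []                               ∎
    where open ∼-Reasoning

  cancelˡ : ∀ u {v w} → u ++ v ∼ u ++ w → v ∼ w
  cancelˡ u {v} {w} uv∼uw = begin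
    v                      ∼⟨ ∼-sym (cancel v) ⟩
    reverse u ++ (u ++ v)  ∼⟨ ++-congˡ (reverse u) uv∼uw ⟩
    reverse u ++ (u ++ w)  ∼⟨ cancel w ⟩
    w                      ∎
    where
    open ∼-Reasoning
    cancel : ∀ x → reverse u ++ (u ++ x) ∼ x
    cancel x = ∼-trans (≡⇒∼ (sym (++-assoc (reverse u) u x))) (++-congʳ x (reverse-inverseˡ u))

  cancelʳ : ∀ u {v w} → v ++ u ∼ w ++ u → v ∼ w
  cancelʳ u {v} {w} vu∼wu = begin
    v                       ∼⟨ ∼-sym (cancel v) ⟩
    (v ++ u) ++ reverse u   ∼⟨ ++-congʳ (reverse u) vu∼wu ⟩
    (w ++ u) ++ reverse u   ∼⟨ cancel w ⟩
    w                       ∎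
    where
    open ∼-Reasoning
    cancel : ∀ x → (x ++ u) ++ reverse u ∼ x
    cancel x = ∼-trans (≡⇒∼ (++-assoc x u (reverse u)))
                       (∼-trans (++-congˡ x (reverse-inverseʳ u)) (≡⇒∼ (++-identityʳ x)))

  ++∼ε⇒∼reverse : ∀ {u} v → u ++ v ∼ [] → u ∼ reverse v
  ++∼ε⇒∼reverse v uv∼ε = cancelʳ v (∼-trans uv∼ε (∼-sym (reverse-inverseˡ v)))

  xy∼ε⇒y∼x : ∀ {x y} → x ∷ y ∷ [] ∼ [] → [ y ] ∼ [ x ]
  xy∼ε⇒y∼x {x} xy∼ε = cancelˡ [ x ] (∼-trans xy∼ε (∼-sym (x²∼ε x)))

  xyz∼ε⇒z∼yx : ∀ {x y z} → x ∷ y ∷ z ∷ [] ∼ [] → [ z ] ∼ y ∷ x ∷ []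
  xyz∼ε⇒z∼yx {x} {y} xyz∼ε = cancelˡ (x ∷ y ∷ []) (∼-trans xyz∼ε (∼-sym xyyx∼ε))
    where
    xyyx∼ε : x ∷ y ∷ y ∷ x ∷ [] ∼ []
    xyyx∼ε = ∼-trans (++-congˡ [ x ] (++-congʳ [ x ] (x²∼ε y))) (x²∼ε x)

  ^ʷ-cong : ∀ {u v} j → u ∼ v → u ^ʷ j ∼ v ^ʷ j
  ^ʷ-cong zero _ = ∼-refl
  ^ʷ-cong (suc j) u∼v = ++-cong u∼v (^ʷ-cong j u∼v)

  ε^ʷ : ∀ {u} j → u ∼ [] → u ^ʷ j ∼ []
  ε^ʷ zero _ = ∼-refl
  ε^ʷ (suc j) u∼ε = ++-cong u∼ε (ε^ʷ j u∼ε)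

record HasOrder (C : FCongruence) (w : Word) (k : ℕ) : Set where
  open FCongruence C
  field
    w^k∼ε   : w ^ʷ k ∼ []
    minimal : ∀ {j} → 0 < j → j < k → ¬ w ^ʷ j ∼ []

presented : Exps → FCongruence
presented e = record
  { _∼_ = _≈⟨ e ⟩_ ; ∼-refl = ≈refl ; ∼-sym = ≈sym ; ∼-trans = ≈trans ; ++-cong = ≈cong
  ; x²∼ε = λ { t → rel-t² ; l → rel-l² ; r → rel-r² } ; [tl]²∼ε = rel-tl² }

-- A record rather than Defs._≈G_, so that the two words can be inferred.
infix 4 _≈[_]_
record _≈[_]_ {n} (u : Word) (M : Map n) (v : Word) : Set where
  constructor mk≈
  field ≈G : _≈G_ M u v
open _≈[_]_ public

monodromy : ∀ {n} → Map n → FCongruence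
monodromy M = record
  { _∼_ = λ u v → u ≈[ M ] v
  ; ∼-refl = mk≈ λ _ → refl
  ; ∼-sym = λ p → mk≈ λ z → sym (≈G p z)
  ; ∼-trans = λ p q → mk≈ λ z → trans (≈G p z) (≈G q z)
  ; ++-cong = λ {u} {u'} {v} {v'} p q → mk≈ λ z → begin
      act (gen M) z (u ++ v)              ≡⟨ act-++ (gen M) z u v ⟩
      act (gen M) (act (gen M) z u) v     ≡⟨ cong (λ y → act (gen M) y v) (≈G p z) ⟩
      act (gen M) (act (gen M) z u') v    ≡⟨ ≈G q _ ⟩
      act (gen M) (act (gen M) z u') v'   ≡⟨ act-++ (gen M) z u' v' ⟨
      act (gen M) z (u' ++ v')            ∎
  ; x²∼ε = λ { t → mk≈ (t² M) ; l → mk≈ (l² M) ; r → mk≈ (r² M) }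
  ; [tl]²∼ε = mk≈ (tl² M) }
  where open ≡-Reasoning

record RelatorsHold (C : FCongruence) (e : Exps) : Set where
  open FCongruence C
  open Exps e
  field
    T^e₁   : (t ∷ []) ^ʷ e₁ ∼ []
    L^e₂   : (l ∷ []) ^ʷ e₂ ∼ []
    R^e₃   : (r ∷ []) ^ʷ e₃ ∼ []
    TL^e₄  : (t ∷ l ∷ []) ^ʷ e₄ ∼ []
    TR^e₅  : (t ∷ r ∷ []) ^ʷ e₅ ∼ []
    LR^e₆  : (l ∷ r ∷ []) ^ʷ e₆ ∼ []
    TLR^e₇ : (t ∷ l ∷ r ∷ []) ^ʷ e₇ ∼ []

module _ {C : FCongruence} {e : Exps} (holds : RelatorsHold C e) where
  open FCongruence C
  open RelatorsHold holds

  ≈⟨⟩⇒∼ : ∀ {u v} → u ≈⟨ e ⟩ v → u ∼ v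
  ≈⟨⟩⇒∼ ≈refl = ∼-refl
  ≈⟨⟩⇒∼ (≈sym p) = ∼-sym (≈⟨⟩⇒∼ p)
  ≈⟨⟩⇒∼ (≈trans p q) = ∼-trans (≈⟨⟩⇒∼ p) (≈⟨⟩⇒∼ q)
  ≈⟨⟩⇒∼ (≈cong p q) = ++-cong (≈⟨⟩⇒∼ p) (≈⟨⟩⇒∼ q)
  ≈⟨⟩⇒∼ rel-t² = x²∼ε t
  ≈⟨⟩⇒∼ rel-l² = x²∼ε l
  ≈⟨⟩⇒∼ rel-r² = x²∼ε r
  ≈⟨⟩⇒∼ rel-tl² = [tl]²∼ε
  ≈⟨⟩⇒∼ rel₁ = T^e₁
  ≈⟨⟩⇒∼ rel₂ = L^e₂
  ≈⟨⟩⇒∼ rel₃ = R^e₃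
  ≈⟨⟩⇒∼ rel₄ = TL^e₄
  ≈⟨⟩⇒∼ rel₅ = TR^e₅
  ≈⟨⟩⇒∼ rel₆ = LR^e₆
  ≈⟨⟩⇒∼ rel₇ = TLR^e₇

-- Dihedral normal forms

data AB : Set where
  A B : AB

spell : Gen → Gen → List AB → Word
spell a b = map λ { A → a ; B → b }

module DihedralWords (a b : Gen) where

  ρ : Word
  ρ = a ∷ b ∷ []

  NormalForm : Set
  NormalForm = ℕ × Bool

  reflection : Bool → Word
  reflection true = [ a ]
  reflection false = []

  ⌜_⌝ : NormalForm → Word
  ⌜ i , s ⌝ = (ρ ^ʷ i) ++ reflection s

  module _ (C : FCongruence) (spelling : Gen → List AB)
           (spelled : ∀ x → FCongruence._∼_ C [ x ] (spell a b (spelling x))) where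
    open FCongruence C

    spelled-word : ∀ w → w ∼ spell a b (concatMap spelling w)
    spelled-word [] = ∼-refl
    spelled-word (x ∷ w) = ∼-trans (++-cong (spelled x) (spelled-word w))
      (≡⇒∼ (sym (map-++ _ (spelling x) (concatMap spelling w))))

    ≤2-elements : ∀ {y} → [ a ] ∼ [] ⊎ [ a ] ∼ [ y ] → [ b ] ∼ [] ⊎ [ b ] ∼ [ y ] →
      ∀ w → w ∼ [] ⊎ w ∼ [ y ]
    ≤2-elements {y} a∈ b∈ w = ∈-resp (spelled-word w) (spell-∈ (concatMap spelling w))
      where
      _∈⟨y⟩ : Word → Set
      u ∈⟨y⟩ = u ∼ [] ⊎ u ∼ [ y ]
      ∈-resp : ∀ {u v} → u ∼ v → v ∈⟨y⟩ → u ∈⟨y⟩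
      ∈-resp u∼v = Sum.map (∼-trans u∼v) (∼-trans u∼v)
      ++-∈ : ∀ {u v} → u ∈⟨y⟩ → v ∈⟨y⟩ → (u ++ v) ∈⟨y⟩
      ++-∈ (inj₁ u∼ε) (inj₁ v∼ε) = inj₁ (++-cong u∼ε v∼ε)
      ++-∈ (inj₁ u∼ε) (inj₂ v∼y) = inj₂ (++-cong u∼ε v∼y)
      ++-∈ (inj₂ u∼y) (inj₁ v∼ε) = inj₂ (++-cong u∼y v∼ε)
      ++-∈ (inj₂ u∼y) (inj₂ v∼y) = inj₁ (∼-trans (++-cong u∼y v∼y) (x²∼ε y))
      spell-∈ : ∀ xs → spell a b xs ∈⟨y⟩
      spell-∈ [] = inj₁ ∼-refl
      spell-∈ (A ∷ xs) = ++-∈ {[ a ]} a∈ (spell-∈ xs)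
      spell-∈ (B ∷ xs) = ++-∈ {[ b ]} b∈ (spell-∈ xs)

  module Normalisation (k-1 : ℕ) (spelling : Gen → List AB) where

    k : ℕ
    k = suc k-1

    rotate : ℕ → ℕ
    rotate i with suc i ≟ k
    ... | yes _ = 0
    ... | no _ = suc i

    step : NormalForm → AB → NormalForm
    step (i , s) A = i , not s
    step (i , true) B = rotate i , false
    step (zero , false) B = k-1 , true
    step (suc i , false) B = i , true

    normalise : Word → NormalForm
    normalise w = foldl step (0 , false) (concatMap spelling w)

    Valid : NormalForm → Set
    Valid (i , _) = i < k

    step-valid : ∀ σ x → Valid σ → Valid (step σ x)
    step-valid (i , s) A i<k = i<k
    step-valid (i , true) B i<k with suc i ≟ k
    ... | yes _ = z<s
    ... | no i+1≢k = ≤∧≢⇒< i<k i+1≢k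
    step-valid (zero , false) B _ = n<1+n k-1
    step-valid (suc i , false) B i<k = <-trans (n<1+n i) i<k

    foldl-valid : ∀ σ xs → Valid σ → Valid (foldl step σ xs)
    foldl-valid σ [] σ-valid = σ-valid
    foldl-valid σ (x ∷ xs) σ-valid = foldl-valid (step σ x) xs (step-valid σ x σ-valid)

    normalise-valid : ∀ w → proj₁ (normalise w) < k
    normalise-valid w = foldl-valid (0 , false) (concatMap spelling w) z<s

    module _ (C : FCongruence) (ρ^k∼ε : FCongruence._∼_ C (ρ ^ʷ k) [])
             (spelled : ∀ x → FCongruence._∼_ C [ x ] (spell a b (spelling x))) where
      open FCongruence C

      ⌜⌝a∼⌜stepA⌝ : ∀ σ → ⌜ σ ⌝ ++ [ a ] ∼ ⌜ step σ A ⌝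
      ⌜⌝a∼⌜stepA⌝ (i , false) = ≡⇒∼ (cong (_++ [ a ]) (++-identityʳ (ρ ^ʷ i)))
      ⌜⌝a∼⌜stepA⌝ (i , true) =
        ∼-trans (≡⇒∼ (++-assoc (ρ ^ʷ i) [ a ] [ a ])) (++-congˡ (ρ ^ʷ i) (x²∼ε a))

      ρ^[1+i]∼ρ^rotate : ∀ i → ρ ^ʷ suc i ∼ ρ ^ʷ rotate i
      ρ^[1+i]∼ρ^rotate i with suc i ≟ k
      ... | yes refl = ρ^k∼ε
      ... | no _ = ∼-refl

      ⌜⌝b∼⌜stepB⌝ : ∀ σ → ⌜ σ ⌝ ++ [ b ] ∼ ⌜ step σ B ⌝
      ⌜⌝b∼⌜stepB⌝ (i , true) = begin
        ((ρ ^ʷ i) ++ [ a ]) ++ [ b ]  ≡⟨ ++-assoc (ρ ^ʷ i) [ a ] [ b ] ⟩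
        (ρ ^ʷ i) ++ ρ                 ≡⟨ ^ʷ-suc ρ i ⟨
        ρ ^ʷ suc i                    ∼⟨ ρ^[1+i]∼ρ^rotate i ⟩
        ρ ^ʷ rotate i                 ≡⟨ ++-identityʳ _ ⟨
        ⌜ rotate i , false ⌝          ∎
        where open ∼-Reasoning
      ⌜⌝b∼⌜stepB⌝ (zero , false) = begin
        [ b ]                          ∼⟨ ++-congʳ [ b ] (∼-sym ρ^k∼ε) ⟩
        (ρ ^ʷ k) ++ [ b ]              ≡⟨ cong (_++ [ b ]) (^ʷ-suc ρ k-1) ⟩
        ((ρ ^ʷ k-1) ++ ρ) ++ [ b ]     ≡⟨ ++-assoc (ρ ^ʷ k-1) ρ [ b ] ⟩
        (ρ ^ʷ k-1) ++ a ∷ b ∷ b ∷ []   ∼⟨ ++-congˡ (ρ ^ʷ k-1) (++-congˡ [ a ] (x²∼ε b)) ⟩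
        ⌜ k-1 , true ⌝                 ∎
        where open ∼-Reasoning
      ⌜⌝b∼⌜stepB⌝ (suc i , false) = begin
        ((ρ ^ʷ suc i) ++ []) ++ [ b ]  ≡⟨ cong (_++ [ b ]) (trans (++-identityʳ _) (^ʷ-suc ρ i)) ⟩
        ((ρ ^ʷ i) ++ ρ) ++ [ b ]       ≡⟨ ++-assoc (ρ ^ʷ i) ρ [ b ] ⟩
        (ρ ^ʷ i) ++ a ∷ b ∷ b ∷ []     ∼⟨ ++-congˡ (ρ ^ʷ i) (++-congˡ [ a ] (x²∼ε b)) ⟩
        ⌜ i , true ⌝                   ∎
        where open ∼-Reasoning

      ⌜⌝-foldl : ∀ σ xs → ⌜ σ ⌝ ++ spell a b xs ∼ ⌜ foldl step σ xs ⌝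
      ⌜⌝-foldl σ [] = ≡⇒∼ (++-identityʳ _)
      ⌜⌝-foldl σ (x ∷ xs) = begin
        ⌜ σ ⌝ ++ spell a b (x ∷ xs)               ≡⟨ ++-assoc ⌜ σ ⌝ (spell a b [ x ]) (spell a b xs) ⟨
        (⌜ σ ⌝ ++ spell a b [ x ]) ++ spell a b xs ∼⟨ ++-congʳ (spell a b xs) (step-sound x) ⟩
        ⌜ step σ x ⌝ ++ spell a b xs               ∼⟨ ⌜⌝-foldl (step σ x) xs ⟩
        ⌜ foldl step σ (x ∷ xs) ⌝                  ∎
        where
        open ∼-Reasoning
        step-sound : ∀ x → ⌜ σ ⌝ ++ spell a b [ x ] ∼ ⌜ step σ x ⌝
        step-sound A = ⌜⌝a∼⌜stepA⌝ σ
        step-sound B = ⌜⌝b∼⌜stepB⌝ σ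

      normalise-sound : ∀ w → w ∼ ⌜ normalise w ⌝
      normalise-sound w = ∼-trans (spelled-word C spelling spelled w) (⌜⌝-foldl (0 , false) (concatMap spelling w))

  module Distinctness (C : FCongruence) (k : ℕ) (ρ-order : HasOrder C ρ k) where
    open FCongruence C
    open HasOrder ρ-order renaming (w^k∼ε to ρ^k∼ε)

    ρ^-split : ∀ {i j} → i ≤ j → ρ ^ʷ j ≡ (ρ ^ʷ i) ++ (ρ ^ʷ (j ∸ i))
    ρ^-split {i} {j} i≤j = trans (cong (ρ ^ʷ_) (sym (m+[n∸m]≡n i≤j))) (^ʷ-+ ρ i (j ∸ i))

    ρ^-injective-≤ : ∀ {i j} → i ≤ j → j < k → ρ ^ʷ i ∼ ρ ^ʷ j → i ≡ j
    ρ^-injective-≤ {i} {j} i≤j j<k ρ^i∼ρ^j with j ∸ i in j∸i≡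
    ... | zero = ≤-antisym i≤j (m∸n≡0⇒m≤n j∸i≡)
    ... | suc d = contradiction ρ^[1+d]∼ε (minimal z<s (≤-<-trans (subst (_≤ j) j∸i≡ (m∸n≤m j i)) j<k))
      where
      ρ^[1+d]∼ε : ρ ^ʷ suc d ∼ []
      ρ^[1+d]∼ε = ∼-sym (cancelˡ (ρ ^ʷ i) (begin
        (ρ ^ʷ i) ++ []           ≡⟨ ++-identityʳ _ ⟩
        ρ ^ʷ i                   ∼⟨ ρ^i∼ρ^j ⟩
        ρ ^ʷ j                   ≡⟨ ρ^-split i≤j ⟩
        (ρ ^ʷ i) ++ ρ ^ʷ (j ∸ i) ≡⟨ cong (λ d → (ρ ^ʷ i) ++ ρ ^ʷ d) j∸i≡ ⟩
        (ρ ^ʷ i) ++ ρ ^ʷ suc d   ∎))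
        where open ∼-Reasoning

    ρ^-injective : ∀ {i j} → i < k → j < k → ρ ^ʷ i ∼ ρ ^ʷ j → i ≡ j
    ρ^-injective {i} {j} i<k j<k ρ^i∼ρ^j with ≤-total i j
    ... | inj₁ i≤j = ρ^-injective-≤ i≤j j<k ρ^i∼ρ^j
    ... | inj₂ j≤i = sym (ρ^-injective-≤ j≤i i<k (∼-sym ρ^i∼ρ^j))

    ρ^d++a∼ε⇒a∈⟨ρ⟩ : ∀ {d} → d < k → (ρ ^ʷ d) ++ [ a ] ∼ [] → ∃[ m ] (m < k × [ a ] ∼ ρ ^ʷ m)
    ρ^d++a∼ε⇒a∈⟨ρ⟩ {zero} d<k a∼ε = 0 , d<k , a∼ε
    ρ^d++a∼ε⇒a∈⟨ρ⟩ {suc d} d<k ρ^d++a∼ε = k ∸ suc d , ∸-monoʳ-< z<s (<⇒≤ d<k) , ∼-sym (begin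
      ρ ^ʷ (k ∸ suc d)                            ≡⟨ ++-identityʳ _ ⟨
      (ρ ^ʷ (k ∸ suc d)) ++ []                    ∼⟨ ++-congˡ (ρ ^ʷ (k ∸ suc d)) (∼-sym ρ^d++a∼ε) ⟩
      (ρ ^ʷ (k ∸ suc d)) ++ (ρ ^ʷ suc d) ++ [ a ] ≡⟨ ++-assoc (ρ ^ʷ (k ∸ suc d)) (ρ ^ʷ suc d) [ a ] ⟨
      ((ρ ^ʷ (k ∸ suc d)) ++ ρ ^ʷ suc d) ++ [ a ] ≡⟨ cong (_++ [ a ]) (^ʷ-+ ρ (k ∸ suc d) (suc d)) ⟨
      (ρ ^ʷ (k ∸ suc d + suc d)) ++ [ a ]         ≡⟨ cong (λ n → (ρ ^ʷ n) ++ [ a ]) (m∸n+n≡m (<⇒≤ d<k)) ⟩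
      (ρ ^ʷ k) ++ [ a ]                           ∼⟨ ++-congʳ [ a ] ρ^k∼ε ⟩
      [ a ]                                       ∎)
      where open ∼-Reasoning

    module _ (a∉⟨ρ⟩ : ∀ {m} → m < k → ¬ [ a ] ∼ ρ ^ʷ m) where

      reflection≁rotation : ∀ {i j} → i < k → j < k → ¬ (ρ ^ʷ i) ++ [ a ] ∼ ρ ^ʷ j
      reflection≁rotation {i} {j} i<k j<k ρ^i++a∼ρ^j with ≤-total i j
      ... | inj₁ i≤j = a∉⟨ρ⟩ (≤-<-trans (m∸n≤m j i) j<k)
        (cancelˡ (ρ ^ʷ i) (∼-trans ρ^i++a∼ρ^j (≡⇒∼ (ρ^-split i≤j))))
      ... | inj₂ j≤i with ρ^d++a∼ε⇒a∈⟨ρ⟩ (≤-<-trans (m∸n≤m i j) i<k) ρ^[i-j]++a∼ε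
        where
        ρ^[i-j]++a∼ε : (ρ ^ʷ (i ∸ j)) ++ [ a ] ∼ []
        ρ^[i-j]++a∼ε = cancelˡ (ρ ^ʷ j) (begin
          (ρ ^ʷ j) ++ (ρ ^ʷ (i ∸ j)) ++ [ a ]   ≡⟨ ++-assoc (ρ ^ʷ j) (ρ ^ʷ (i ∸ j)) [ a ] ⟨
          ((ρ ^ʷ j) ++ ρ ^ʷ (i ∸ j)) ++ [ a ]   ≡⟨ cong (_++ [ a ]) (ρ^-split j≤i) ⟨
          (ρ ^ʷ i) ++ [ a ]                     ∼⟨ ρ^i++a∼ρ^j ⟩
          ρ ^ʷ j                                ≡⟨ ++-identityʳ _ ⟨
          (ρ ^ʷ j) ++ []                        ∎)
          where open ∼-Reasoning
      ... | m , m<k , a∼ρ^m = a∉⟨ρ⟩ m<k a∼ρ^m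

      ⌜⌝-injective : ∀ {σ σ'} → proj₁ σ < k → proj₁ σ' < k → ⌜ σ ⌝ ∼ ⌜ σ' ⌝ → σ ≡ σ'
      ⌜⌝-injective {i , false} {j , false} i<k j<k σ∼σ' = cong (_, false) (ρ^-injective i<k j<k
        (∼-trans (≡⇒∼ (sym (++-identityʳ _))) (∼-trans σ∼σ' (≡⇒∼ (++-identityʳ _)))))
      ⌜⌝-injective {i , true} {j , true} i<k j<k σ∼σ' =
        cong (_, true) (ρ^-injective i<k j<k (cancelʳ [ a ] σ∼σ'))
      ⌜⌝-injective {i , true} {j , false} i<k j<k σ∼σ' =
        contradiction (∼-trans σ∼σ' (≡⇒∼ (++-identityʳ _))) (reflection≁rotation i<k j<k)
      ⌜⌝-injective {i , false} {j , true} i<k j<k σ∼σ' =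
        contradiction (∼-trans (∼-sym σ∼σ') (≡⇒∼ (++-identityʳ _))) (reflection≁rotation j<k i<k)

    a∼ρ^m⇒ρ²∼ε : ∀ {m} → [ a ] ∼ ρ ^ʷ m → ρ ^ʷ 2 ∼ []
    a∼ρ^m⇒ρ²∼ε {m} a∼ρ^m = cancelˡ (ρ ^ʷ (m + m)) (begin
      (ρ ^ʷ (m + m)) ++ ρ ^ʷ 2     ≡⟨ ^ʷ-+ ρ (m + m) 2 ⟨
      ρ ^ʷ (m + m + 2)             ≡⟨ cong (ρ ^ʷ_) (trans (+-comm (m + m) 2) (cong suc (sym (+-suc m m)))) ⟩
      ρ ^ʷ (suc m + suc m)         ≡⟨ ^ʷ-+ ρ (suc m) (suc m) ⟩
      (ρ ^ʷ suc m) ++ ρ ^ʷ suc m   ∼⟨ ++-cong (∼-sym b∼ρ^[1+m]) (∼-sym b∼ρ^[1+m]) ⟩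
      b ∷ b ∷ []                   ∼⟨ x²∼ε b ⟩
      []                           ∼⟨ ∼-sym (x²∼ε a) ⟩
      a ∷ a ∷ []                   ∼⟨ ++-cong a∼ρ^m a∼ρ^m ⟩
      (ρ ^ʷ m) ++ ρ ^ʷ m           ≡⟨ ^ʷ-+ ρ m m ⟨
      ρ ^ʷ (m + m)                 ≡⟨ ++-identityʳ _ ⟨
      (ρ ^ʷ (m + m)) ++ []         ∎)
      where
      open ∼-Reasoning
      b∼ρ^[1+m] : [ b ] ∼ ρ ^ʷ suc m
      b∼ρ^[1+m] = begin
        [ b ]             ∼⟨ ++-congʳ [ b ] (∼-sym (x²∼ε a)) ⟩
        a ∷ a ∷ b ∷ []    ∼⟨ ++-congʳ ρ a∼ρ^m ⟩
        (ρ ^ʷ m) ++ ρ     ≡⟨ ^ʷ-suc ρ m ⟨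
        ρ ^ʷ suc m        ∎

    a∉⟨ρ⟩ : ¬ [ a ] ∼ [] → ¬ [ b ] ∼ [] → ∀ {m} → m < k → ¬ [ a ] ∼ ρ ^ʷ m
    a∉⟨ρ⟩ a≁ε _ {0} _ a∼ε = a≁ε a∼ε
    a∉⟨ρ⟩ _ b≁ε {1} _ a∼ab = b≁ε (∼-sym (cancelˡ [ a ] a∼ab))
    a∉⟨ρ⟩ _ _ {suc (suc m)} m<k a∼ρ^m =
      minimal {2} z<s (≤-<-trans (s≤s (s≤s z≤n)) m<k) (a∼ρ^m⇒ρ²∼ε {suc (suc m)} a∼ρ^m)

-- Monodromy groups

least : (Q : ℕ → Set) → Decidable Q → ∀ {K} → Q K → ∃[ k ] (Q k × ∀ {j} → j < k → ¬ Q j)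
least Q Q? {K} QK with search (suc K)
  where
  search : ∀ K → ∃[ k ] (Q k × ∀ {j} → j < k → ¬ Q j) ⊎ (∀ {j} → j < K → ¬ Q j)
  search zero = inj₂ λ ()
  search (suc K) with search K
  ... | inj₁ found = inj₁ found
  ... | inj₂ none-below with Q? K
  ...   | yes QK = inj₁ (K , QK , none-below)
  ...   | no ¬QK = inj₂ λ j<1+K → [ none-below , (λ { refl → ¬QK }) ]′ (m<1+n⇒m<n∨m≡n j<1+K)
... | inj₁ found = found
... | inj₂ none-below = contradiction QK (none-below ≤-refl)

Regular : ∀ {n} → Map n → Set
Regular M = ∀ u v → act (gen M) (root M) u ≡ act (gen M) (root M) v → u ≈[ M ] v

module _ {n} (M : Map n) where
  open FCongruence (monodromy M)

  trivial? : ∀ w → Dec (Trivial M w)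
  trivial? w = Fin.all? λ z → act (gen M) z w Fin.≟ z

  reflexible⇒regular : Reflexible M → Regular M
  reflexible⇒regular (transitive-aut , _) u v root·u≡root·v = mk≈ λ z →
    let α , (_ , _ , α-equivariant) , α-root≡z = transitive-aut (root M) z in begin
      act (gen M) z u               ≡⟨ cong (λ y → act (gen M) y u) α-root≡z ⟨
      act (gen M) (α (root M)) u    ≡⟨ α-equivariant (root M) u ⟨
      α (act (gen M) (root M) u)    ≡⟨ cong α root·u≡root·v ⟩
      α (act (gen M) (root M) v)    ≡⟨ α-equivariant (root M) v ⟩
      act (gen M) (α (root M)) v    ≡⟨ cong (λ y → act (gen M) y v) α-root≡z ⟩
      act (gen M) z v               ∎
    where open ≡-Reasoning

  ∃^ʷ-trivial : Regular M → ∀ w → ∃[ K ] (0 < K × (w ^ʷ K) ≈[ M ] [])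
  ∃^ʷ-trivial regular w with Fin.pigeonhole (n<1+n n) (λ i → act (gen M) (root M) (w ^ʷ toℕ i))
  ... | i , j , i<j , root·w^i≡root·w^j = toℕ j ∸ toℕ i , m<n⇒0<n∸m i<j , ∼-sym (cancelˡ (w ^ʷ toℕ i) (begin
      (w ^ʷ toℕ i) ++ []                     ≡⟨ ++-identityʳ _ ⟩
      w ^ʷ toℕ i                             ∼⟨ regular _ _ root·w^i≡root·w^j ⟩
      w ^ʷ toℕ j                             ≡⟨ cong (w ^ʷ_) (m+[n∸m]≡n (<⇒≤ i<j)) ⟨
      w ^ʷ (toℕ i + (toℕ j ∸ toℕ i))         ≡⟨ ^ʷ-+ w (toℕ i) (toℕ j ∸ toℕ i) ⟩
      (w ^ʷ toℕ i) ++ w ^ʷ (toℕ j ∸ toℕ i)   ∎))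
    where open ∼-Reasoning

  order : Regular M → ∀ w → ∃[ k ] (0 < k × HasOrder (monodromy M) w k)
  order regular w with ∃^ʷ-trivial regular w
  ... | K , 0<K , w^K∼ε with least (λ j → 0 < j × Trivial M (w ^ʷ j)) positive-trivial? (0<K , ≈G w^K∼ε)
    where
    positive-trivial? : ∀ j → Dec (0 < j × Trivial M (w ^ʷ j))
    positive-trivial? j = 0 <? j ×-dec trivial? (w ^ʷ j)
  ... | k , (0<k , w^k∼ε) , below = k , 0<k , record
    { w^k∼ε = mk≈ w^k∼ε ; minimal = λ 0<j j<k w^j∼ε → below j<k (0<j , ≈G w^j∼ε) }

module _ {n} (M : Map n) where

  TrivialSubgroup : NormalSubgroup M → Set
  TrivialSubgroup H = ∀ w → mem H w → Trivial M w

  -- For finite groups this is equivalent to having a unique minimal normal subgroup.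
  Monolithic : Set₁
  Monolithic = ∀ (H₁ H₂ : NormalSubgroup M) → (∀ w → mem H₁ w → mem H₂ w → Trivial M w) →
    ¬ TrivialSubgroup H₁ → ¬ TrivialSubgroup H₂ → ⊥

  ∈-all-nontrivial⇒monolithic : ∀ g → ¬ Trivial M g →
    (∀ H h → mem H h → ¬ Trivial M h → mem H g) → Monolithic
  -- Trivial is decidable, which removes the double negations.
  ∈-all-nontrivial⇒monolithic g g≢ε g∈ H₁ H₂ H₁∩H₂≡ε H₁≢ε H₂≢ε =
    H₁≢ε λ h₁ h₁∈H₁ → decidable-stable (trivial? M h₁) λ h₁≢ε →
    H₂≢ε λ h₂ h₂∈H₂ → decidable-stable (trivial? M h₂) λ h₂≢ε →
    g≢ε (H₁∩H₂≡ε g (g∈ H₁ h₁ h₁∈H₁ h₁≢ε) (g∈ H₂ h₂ h₂∈H₂ h₂≢ε))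

  ≤2-elements⇒monolithic : ∀ g → (∀ w → w ≈[ M ] [] ⊎ w ≈[ M ] g) → Monolithic
  ≤2-elements⇒monolithic g ε-or-g with trivial? M g
  ... | no g≢ε = ∈-all-nontrivial⇒monolithic g g≢ε λ H h h∈H h≢ε →
    [ (λ h≈ε → contradiction (≈G h≈ε) h≢ε) , (λ h≈g → resp H (≈G h≈g) h∈H) ]′ (ε-or-g h)
  ... | yes g≡ε = λ H₁ _ _ H₁≢ε _ → H₁≢ε λ w _ →
    [ ≈G , (λ w≈g z → trans (≈G w≈g z) (g≡ε z)) ]′ (ε-or-g w)

module _ {n n' n₁ n₂} {M : Map n} {M' : Map n'} {M₁ : Map n₁} {M₂ : Map n₂} {H : NormalSubgroup M} where

  IsoPar-along-trivial-quotient : IsoQuot M M' H → TrivialSubgroup M H → IsoPar M M₁ M₂ → IsoPar M' M₁ M₂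
  IsoPar-along-trivial-quotient (π , π-root , π-equivariant , π-fibres , π-surjective , π-kernel) H≡ε
    (φ , φ-root , φ-equivariant , φ-injective , φ-orbit , φ-surjective , φ-kernel) =
    φ ∘ ι , φι-root , φι-equivariant , φι-injective , φ-orbit ∘ ι , φι-surjective , φι-kernel
    where
    π-injective : ∀ z z' → π z ≡ π z' → z ≡ z'
    π-injective z z' πz≡πz' = let h , h∈H , z·h≡z' = to (π-fibres z z') πz≡πz' in
      trans (sym (H≡ε h h∈H z)) z·h≡z'
    ι : Fin n' → Fin n
    ι z' = proj₁ (π-surjective z')
    πι : ∀ z' → π (ι z') ≡ z'
    πι z' = proj₂ (π-surjective z')
    ιπ : ∀ z → ι (π z) ≡ z
    ιπ z = π-injective _ _ (πι (π z))
    ι-root : ι (root M') ≡ root M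
    ι-root = trans (cong ι (sym π-root)) (ιπ (root M))
    ι-equivariant : ∀ z x → ι (gen M' x z) ≡ gen M x (ι z)
    ι-equivariant z x = begin
      ι (gen M' x z)           ≡⟨ cong (λ y → ι (gen M' x y)) (πι z) ⟨
      ι (gen M' x (π (ι z)))   ≡⟨ cong ι (π-equivariant (ι z) x) ⟨
      ι (π (gen M x (ι z)))    ≡⟨ ιπ _ ⟩
      gen M x (ι z)            ∎
      where open ≡-Reasoning
    φι-root = trans (cong φ ι-root) φ-root
    φι-equivariant : ∀ z x → φ (ι (gen M' x z)) ≡ (let (a , b) = φ (ι z) in gen M₁ x a , gen M₂ x b)
    φι-equivariant z x = trans (cong φ (ι-equivariant z x)) (φ-equivariant (ι z) x)
    φι-injective : ∀ z z' → φ (ι z) ≡ φ (ι z') → z ≡ z'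
    φι-injective z z' φιz≡φιz' = trans (sym (πι z)) (trans (cong π (φ-injective _ _ φιz≡φιz')) (πι z'))
    φι-surjective : ∀ w → ∃[ z ] φ (ι z) ≡ (act (gen M₁) (root M₁) w , act (gen M₂) (root M₂) w)
    φι-surjective w = let z , φz≡ = φ-surjective w in π z , trans (cong φ (ιπ z)) φz≡
    φι-kernel : ∀ w → Trivial M' w ⇔ (Trivial M₁ w × Trivial M₂ w)
    φι-kernel w = mk⇔
      (λ w≡ε → to (φ-kernel w) (H≡ε w (to (π-kernel w) w≡ε)))
      (λ w≡ε₁₂ → from (π-kernel w) (resp H (λ z → sym (from (φ-kernel w) w≡ε₁₂ z)) (has-id H)))

quotient-kernel : ∀ {n n'} {M : Map n} {M' : Map n'} {H} → IsoQuot M M' H →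
  ∀ w → Trivial M' w ⇔ mem H w
quotient-kernel (_ , _ , _ , _ , _ , kernel) = kernel

parallel-kernel : ∀ {n n₁ n₂} {M : Map n} {M₁ : Map n₁} {M₂ : Map n₂} → IsoPar M M₁ M₂ →
  ∀ w → Trivial M w ⇔ (Trivial M₁ w × Trivial M₂ w)
parallel-kernel (_ , _ , _ , _ , _ , _ , kernel) = kernel

decomposable⇒¬monolithic : ∀ {n} (M : Map n) → Decomposable M → ¬ Monolithic M
decomposable⇒¬monolithic M
  (_ , _ , M₁ , M₂ , (H₁ , M₁≅M/H₁) , (H₂ , M₂≅M/H₂) , M≅M₁∥M₂ , M₁≇M₁∥M₂ , M₂≇M₁∥M₂) monolithic =
  monolithic H₁ H₂ H₁∩H₂≡ε
    (λ H₁≡ε → M₁≇M₁∥M₂ (IsoPar-along-trivial-quotient {M = M} {M₁} {M₁} {M₂} {H₁}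
                          M₁≅M/H₁ H₁≡ε M≅M₁∥M₂))
    (λ H₂≡ε → M₂≇M₁∥M₂ (IsoPar-along-trivial-quotient {M = M} {M₂} {M₁} {M₂} {H₂}
                          M₂≅M/H₂ H₂≡ε M≅M₁∥M₂))
  where
  H₁∩H₂≡ε : ∀ w → mem H₁ w → mem H₂ w → Trivial M w
  H₁∩H₂≡ε w w∈H₁ w∈H₂ = from (parallel-kernel {M = M} {M₁} {M₂} M≅M₁∥M₂ w)
    ( from (quotient-kernel {M = M} {M₁} {H₁} M₁≅M/H₁ w) w∈H₁
    , from (quotient-kernel {M = M} {M₂} {H₂} M₂≅M/H₂ w) w∈H₂)

module _ {n} {M : Map n} (H : NormalSubgroup M) where
  open FCongruence (monodromy M)

  ∈-resp : ∀ {u v} → u ∼ v → mem H u → mem H v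
  ∈-resp u∼v = resp H (≈G u∼v)

  ^ʷ-∈ : ∀ {u} j → mem H u → mem H (u ^ʷ j)
  ^ʷ-∈ zero _ = has-id H
  ^ʷ-∈ (suc j) u∈H = closed-∙ H u∈H (^ʷ-∈ j u∈H)

  ^ʷ-gcd-∈ : ∀ {w i k} → w ^ʷ k ∼ [] → mem H (w ^ʷ i) → mem H (w ^ʷ gcd i k)
  ^ʷ-gcd-∈ {w} {i} {k} w^k∼ε w^i∈H with Bézout.identity (gcd-GCD i k)
  ... | Bézout.+- x y d+yk≡xi = ∈-resp w^xi∼w^d (subst (mem H) (sym (^ʷ-* w i x)) (^ʷ-∈ x w^i∈H))
    where
    w^xi∼w^d : w ^ʷ (x * i) ∼ w ^ʷ gcd i k
    w^xi∼w^d = begin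
      w ^ʷ (x * i)                       ≡⟨ cong (w ^ʷ_) d+yk≡xi ⟨
      w ^ʷ (gcd i k + y * k)             ≡⟨ ^ʷ-+ w (gcd i k) (y * k) ⟩
      (w ^ʷ gcd i k) ++ w ^ʷ (y * k)     ≡⟨ cong ((w ^ʷ gcd i k) ++_) (^ʷ-* w k y) ⟩
      (w ^ʷ gcd i k) ++ (w ^ʷ k) ^ʷ y    ∼⟨ ++-congˡ (w ^ʷ gcd i k) (ε^ʷ y w^k∼ε) ⟩
      (w ^ʷ gcd i k) ++ []               ≡⟨ ++-identityʳ _ ⟩
      w ^ʷ gcd i k                       ∎
      where open ∼-Reasoning
  ... | Bézout.-+ x y d+xi≡yk =
    ∈-resp (∼-sym w^d∼w^-xi) (closed-⁻¹ H (subst (mem H) (sym (^ʷ-* w i x)) (^ʷ-∈ x w^i∈H)))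
    where
    w^d∼w^-xi : w ^ʷ gcd i k ∼ reverse (w ^ʷ (x * i))
    w^d∼w^-xi = ++∼ε⇒∼reverse (w ^ʷ (x * i)) (begin
      (w ^ʷ gcd i k) ++ w ^ʷ (x * i)    ≡⟨ ^ʷ-+ w (gcd i k) (x * i) ⟨
      w ^ʷ (gcd i k + x * i)            ≡⟨ cong (w ^ʷ_) d+xi≡yk ⟩
      w ^ʷ (y * k)                      ≡⟨ ^ʷ-* w k y ⟩
      (w ^ʷ k) ^ʷ y                     ∼⟨ ε^ʷ y w^k∼ε ⟩
      []                                ∎)
      where open ∼-Reasoning

  module _ (a b : Gen) where
    open DihedralWords a b

    ρ^i·a∈H⇒ρ²∈H : ∀ i → mem H ((ρ ^ʷ i) ++ [ a ]) → mem H (ρ ^ʷ 2)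
    ρ^i·a∈H⇒ρ²∈H i h∈H = ∈-resp (begin
      reverse ρ^2i ++ ρ^2i ++ ρ ^ʷ 2     ≡⟨ ++-assoc (reverse ρ^2i) ρ^2i (ρ ^ʷ 2) ⟨
      (reverse ρ^2i ++ ρ^2i) ++ ρ ^ʷ 2   ∼⟨ ++-congʳ (ρ ^ʷ 2) (reverse-inverseˡ ρ^2i) ⟩
      ρ ^ʷ 2                             ∎)
      (closed-∙ H (closed-⁻¹ H (∈-resp h·aha∼ρ^2i h·aha∈H)) (∈-resp h·bhb∼ρ^2i·ρ² h·bhb∈H))
      where
      open ∼-Reasoning
      ρ^2i = ρ ^ʷ (i + i)
      h = (ρ ^ʷ i) ++ [ a ]
      h·aha∈H : mem H (h ++ [ a ] ++ h ++ [ a ])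
      h·aha∈H = closed-∙ H h∈H (normal H h∈H [ a ])
      h·bhb∈H : mem H (h ++ [ b ] ++ h ++ [ b ])
      h·bhb∈H = closed-∙ H h∈H (normal H h∈H [ b ])
      ha∼ρ^i : h ++ [ a ] ∼ ρ ^ʷ i
      ha∼ρ^i = begin
        ((ρ ^ʷ i) ++ [ a ]) ++ [ a ]   ≡⟨ ++-assoc (ρ ^ʷ i) [ a ] [ a ] ⟩
        (ρ ^ʷ i) ++ a ∷ a ∷ []         ∼⟨ ++-congˡ (ρ ^ʷ i) (x²∼ε a) ⟩
        (ρ ^ʷ i) ++ []                 ≡⟨ ++-identityʳ _ ⟩
        ρ ^ʷ i                         ∎
      hb≡ρ^[1+i] : h ++ [ b ] ≡ ρ ^ʷ suc i
      hb≡ρ^[1+i] = trans (++-assoc (ρ ^ʷ i) [ a ] [ b ]) (sym (^ʷ-suc ρ i))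
      h·aha∼ρ^2i : h ++ [ a ] ++ h ++ [ a ] ∼ ρ ^ʷ (i + i)
      h·aha∼ρ^2i = begin
        h ++ [ a ] ++ h ++ [ a ]       ≡⟨ ++-assoc h [ a ] (h ++ [ a ]) ⟨
        (h ++ [ a ]) ++ h ++ [ a ]     ∼⟨ ++-cong ha∼ρ^i ha∼ρ^i ⟩
        (ρ ^ʷ i) ++ ρ ^ʷ i             ≡⟨ ^ʷ-+ ρ i i ⟨
        ρ ^ʷ (i + i)                   ∎
      h·bhb∼ρ^2i·ρ² : h ++ [ b ] ++ h ++ [ b ] ∼ (ρ ^ʷ (i + i)) ++ ρ ^ʷ 2
      h·bhb∼ρ^2i·ρ² = begin
        h ++ [ b ] ++ h ++ [ b ]         ≡⟨ ++-assoc h [ b ] (h ++ [ b ]) ⟨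
        (h ++ [ b ]) ++ h ++ [ b ]       ≡⟨ cong₂ _++_ hb≡ρ^[1+i] hb≡ρ^[1+i] ⟩
        (ρ ^ʷ suc i) ++ ρ ^ʷ suc i       ≡⟨ ^ʷ-+ ρ (suc i) (suc i) ⟨
        ρ ^ʷ (suc i + suc i)             ≡⟨ cong (ρ ^ʷ_) (trans (cong suc (+-suc i i)) (+-comm 2 (i + i))) ⟩
        ρ ^ʷ (i + i + 2)                 ≡⟨ ^ʷ-+ ρ (i + i) 2 ⟩
        (ρ ^ʷ (i + i)) ++ ρ ^ʷ 2         ∎

module _ {n} (M : Map n) (a b : Gen) (k-1 : ℕ) (spelling : Gen → List AB)
         (spelled : ∀ x → [ x ] ≈[ M ] spell a b (spelling x)) where
  open DihedralWords a b
  open Normalisation k-1 spelling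
  open FCongruence (monodromy M)

  prime-power-order⇒monolithic : HasOrder (monodromy M) ρ k →
    ∀ {p m} → Prime p → k ≡ p ^ suc m → 2 < k → Monolithic M
  -- Every nontrivial normal subgroup contains ρ^(p^m): a reflection in it puts ρ² in it,
  -- a rotation ρ^i puts ρ^(gcd i k) in it, and gcd i k is a proper divisor of p^(1+m).
  prime-power-order⇒monolithic ρ-order {p} {m} p-prime k≡p^[1+m] 2<k =
    ∈-all-nontrivial⇒monolithic M (ρ ^ʷ (p ^ m)) g≢ε g∈
    where
    open HasOrder ρ-order renaming (w^k∼ε to ρ^k∼ε)
    instance _ = prime⇒nonZero p-prime

    p^m<k : p ^ m < k
    p^m<k = subst (p ^ m <_) (sym k≡p^[1+m]) (^-monoʳ-< p (prime>1 p-prime) (n<1+n m))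

    g≢ε : ¬ Trivial M (ρ ^ʷ (p ^ m))
    g≢ε g≡ε = minimal (m^n>0 p m) p^m<k (mk≈ g≡ε)

    rotation-case : ∀ H {i} → 0 < i → i < k → mem H (ρ ^ʷ i) → mem H (ρ ^ʷ (p ^ m))
    rotation-case H {i} 0<i i<k ρ^i∈H with m∣p^[1+n]∧m<p^[1+n]⇒m∣p^n p-prime m d∣p^[1+m] d<p^[1+m]
      where
      instance _ = >-nonZero 0<i
      d∣p^[1+m] : gcd i k ∣ p ^ suc m
      d∣p^[1+m] = subst (gcd i k ∣_) k≡p^[1+m] (gcd[m,n]∣n i k)
      d<p^[1+m] : gcd i k < p ^ suc m
      d<p^[1+m] = subst (gcd i k <_) k≡p^[1+m] (≤-<-trans (∣⇒≤ (gcd[m,n]∣m i k)) i<k)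
    ... | divides q p^m≡qd = subst (mem H) (trans (sym (^ʷ-* ρ (gcd i k) q)) (cong (ρ ^ʷ_) (sym p^m≡qd)))
      (^ʷ-∈ H q (^ʷ-gcd-∈ H {ρ} {i} {k} ρ^k∼ε ρ^i∈H))

    g∈ : ∀ H h → mem H h → ¬ Trivial M h → mem H (ρ ^ʷ (p ^ m))
    g∈ H h h∈H h≢ε with normalise h | normalise-sound (monodromy M) ρ^k∼ε spelled h | normalise-valid h
    ... | i , true | h∼ρ^i·a | _ = rotation-case H z<s 2<k (ρ^i·a∈H⇒ρ²∈H H a b i (∈-resp H h∼ρ^i·a h∈H))
    ... | zero , false | h∼ε | _ = contradiction (≈G h∼ε) h≢ε
    ... | suc i , false | h∼ρ^[1+i] | i<k =
      rotation-case H z<s i<k (∈-resp H (∼-trans h∼ρ^[1+i] (≡⇒∼ (++-identityʳ _))) h∈H)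

-- Degenerate maps

data Degeneracy : Set where
  T L R TL TR LR TLR : Degeneracy

trivialWord : Degeneracy → Word
trivialWord T = t ∷ []
trivialWord L = l ∷ []
trivialWord R = r ∷ []
trivialWord TL = t ∷ l ∷ []
trivialWord TR = t ∷ r ∷ []
trivialWord LR = l ∷ r ∷ []
trivialWord TLR = t ∷ l ∷ r ∷ []

degeneracy : ∀ {n} {M : Map n} → Degenerate M → ∃[ d ] Trivial M (trivialWord d)
degeneracy (inj₁ T≡ε) = T , T≡ε
degeneracy (inj₂ (inj₁ L≡ε)) = L , L≡ε
degeneracy (inj₂ (inj₂ (inj₁ R≡ε))) = R , R≡ε
degeneracy (inj₂ (inj₂ (inj₂ (inj₁ TL≡ε)))) = TL , TL≡ε
degeneracy (inj₂ (inj₂ (inj₂ (inj₂ (inj₁ TR≡ε))))) = TR , TR≡ε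
degeneracy (inj₂ (inj₂ (inj₂ (inj₂ (inj₂ (inj₁ LR≡ε)))))) = LR , LR≡ε
degeneracy (inj₂ (inj₂ (inj₂ (inj₂ (inj₂ (inj₂ TLR≡ε)))))) = TLR , TLR≡ε

-- When trivialWord d is trivial, Mon(M) is generated by the involutions genA d and genB d,
-- and spelling d writes t, l, r as words in them.
genA genB : Degeneracy → Gen
genA T = l
genA _ = t
genB T = r
genB L = r
genB TL = r
genB _ = l

spelling : Degeneracy → Gen → List AB
spelling T = λ { t → [] ; l → [ A ] ; r → [ B ] }
spelling L = λ { t → [ A ] ; l → [] ; r → [ B ] }
spelling TL = λ { t → [ A ] ; l → [ A ] ; r → [ B ] }
spelling R = λ { t → [ A ] ; l → [ B ] ; r → [] }
spelling TR = λ { t → [ A ] ; l → [ B ] ; r → [ A ] }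
spelling LR = λ { t → [ A ] ; l → [ B ] ; r → [ B ] }
spelling TLR = λ { t → [ A ] ; l → [ B ] ; r → B ∷ A ∷ [] }

-- The cases where ρ = tl, so that Mon(M) is a quotient of the Klein four-group.
Klein : Degeneracy → Set
Klein R = ⊤
Klein TR = ⊤
Klein LR = ⊤
Klein TLR = ⊤
Klein _ = ⊥

DM : Degeneracy → ℕ → Exps
DM T = DM₇
DM L = DM₆
DM TL = DM₈
DM R _ = DM₉
DM TR _ = DM₁₀
DM LR _ = DM₁₁
DM TLR _ = DM₁₂

module _ (C : FCongruence) where
  open FCongruence C

  spelled : ∀ d → trivialWord d ∼ [] → ∀ x → [ x ] ∼ spell (genA d) (genB d) (spelling d x)
  spelled T t∼ε t = t∼ε
  spelled T _ l = ∼-refl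
  spelled T _ r = ∼-refl
  spelled L _ t = ∼-refl
  spelled L l∼ε l = l∼ε
  spelled L _ r = ∼-refl
  spelled TL _ t = ∼-refl
  spelled TL tl∼ε l = xy∼ε⇒y∼x tl∼ε
  spelled TL _ r = ∼-refl
  spelled R _ t = ∼-refl
  spelled R _ l = ∼-refl
  spelled R r∼ε r = r∼ε
  spelled TR _ t = ∼-refl
  spelled TR _ l = ∼-refl
  spelled TR tr∼ε r = xy∼ε⇒y∼x tr∼ε
  spelled LR _ t = ∼-refl
  spelled LR _ l = ∼-refl
  spelled LR lr∼ε r = xy∼ε⇒y∼x lr∼ε
  spelled TLR _ t = ∼-refl
  spelled TLR _ l = ∼-refl
  spelled TLR tlr∼ε r = xyz∼ε⇒z∼yx tlr∼ε

  klein-ρ²∼ε : ∀ d → Klein d → let open DihedralWords (genA d) (genB d) in ρ ^ʷ 2 ∼ []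
  klein-ρ²∼ε R _ = [tl]²∼ε
  klein-ρ²∼ε TR _ = [tl]²∼ε
  klein-ρ²∼ε LR _ = [tl]²∼ε
  klein-ρ²∼ε TLR _ = [tl]²∼ε

  private
    ε-xyxy : ∀ {x y} → [ x ] ∼ [] → x ∷ y ∷ x ∷ y ∷ [] ∼ []
    ε-xyxy {x} {y} x∼ε = ∼-trans (++-cong x∼ε (++-congˡ [ y ] (++-congʳ [ y ] x∼ε))) (x²∼ε y)

    -- For k = 2 every word reduces, by computation, to its normal form.
    klein-normalise : ∀ d → Klein d → trivialWord d ∼ [] → ∀ w →
      let open DihedralWords (genA d) (genB d) in w ∼ ⌜ Normalisation.normalise 1 (spelling d) w ⌝
    klein-normalise d klein tw = let open DihedralWords (genA d) (genB d) in
      Normalisation.normalise-sound 1 (spelling d) C (klein-ρ²∼ε d klein) (spelled d tw)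

  relators-hold : ∀ d k → trivialWord d ∼ [] →
    let open DihedralWords (genA d) (genB d) in ρ ^ʷ k ∼ [] → RelatorsHold C (DM d k)
  relators-hold T k t∼ε ρ^k∼ε = record
    { T^e₁ = t∼ε ; L^e₂ = x²∼ε l ; R^e₃ = x²∼ε r ; TL^e₄ = [tl]²∼ε ; TR^e₅ = ε-xyxy t∼ε
    ; LR^e₆ = ρ^k∼ε ; TLR^e₇ = ∼-trans (^ʷ-cong k (++-congʳ (l ∷ r ∷ []) t∼ε)) ρ^k∼ε }
  relators-hold L k l∼ε ρ^k∼ε = record
    { T^e₁ = x²∼ε t ; L^e₂ = l∼ε ; R^e₃ = x²∼ε r ; TL^e₄ = [tl]²∼ε ; TR^e₅ = ρ^k∼ε
    ; LR^e₆ = ε-xyxy l∼ε ; TLR^e₇ = ∼-trans (^ʷ-cong k (++-congˡ [ t ] (++-congʳ [ r ] l∼ε))) ρ^k∼ε }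
  relators-hold TL k tl∼ε ρ^k∼ε = record
    { T^e₁ = x²∼ε t ; L^e₂ = x²∼ε l ; R^e₃ = x²∼ε r ; TL^e₄ = tl∼ε ; TR^e₅ = ρ^k∼ε
    ; LR^e₆ = ∼-trans (^ʷ-cong k (++-congʳ [ r ] (xy∼ε⇒y∼x tl∼ε))) ρ^k∼ε
    ; TLR^e₇ = ∼-trans (++-cong tl∼ε (++-congˡ [ r ] (++-congʳ [ r ] tl∼ε))) (x²∼ε r) }
  relators-hold R _ r∼ε _ = record
    { T^e₁ = N _ ; L^e₂ = N _ ; R^e₃ = N _ ; TL^e₄ = N _ ; TR^e₅ = N _ ; LR^e₆ = N _ ; TLR^e₇ = N _ }
    where N = klein-normalise R _ r∼ε
  relators-hold TR _ tr∼ε _ = record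
    { T^e₁ = N _ ; L^e₂ = N _ ; R^e₃ = N _ ; TL^e₄ = N _ ; TR^e₅ = N _ ; LR^e₆ = N _ ; TLR^e₇ = N _ }
    where N = klein-normalise TR _ tr∼ε
  relators-hold LR _ lr∼ε _ = record
    { T^e₁ = N _ ; L^e₂ = N _ ; R^e₃ = N _ ; TL^e₄ = N _ ; TR^e₅ = N _ ; LR^e₆ = N _ ; TLR^e₇ = N _ }
    where N = klein-normalise LR _ lr∼ε
  relators-hold TLR _ tlr∼ε _ = record
    { T^e₁ = N _ ; L^e₂ = N _ ; R^e₃ = N _ ; TL^e₄ = N _ ; TR^e₅ = N _ ; LR^e₆ = N _ ; TLR^e₇ = N _ }
    where N = klein-normalise TLR _ tlr∼ε

trivialWord-≈ : ∀ d k → trivialWord d ≈⟨ DM d k ⟩ []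
trivialWord-≈ T _ = rel₁
trivialWord-≈ L _ = rel₂
trivialWord-≈ R _ = rel₃
trivialWord-≈ TL _ = rel₄
trivialWord-≈ TR _ = rel₅
trivialWord-≈ LR _ = rel₆
trivialWord-≈ TLR _ = rel₇

ρ^k-≈ : ∀ d k → (Klein d → k ≡ 2) → let open DihedralWords (genA d) (genB d) in (ρ ^ʷ k) ≈⟨ DM d k ⟩ []
ρ^k-≈ T _ _ = rel₆
ρ^k-≈ L _ _ = rel₅
ρ^k-≈ TL _ _ = rel₅
ρ^k-≈ R _ k≡2 with refl ← k≡2 _ = rel₄
ρ^k-≈ TR _ k≡2 with refl ← k≡2 _ = rel₄
ρ^k-≈ LR _ k≡2 with refl ← k≡2 _ = rel₄
ρ^k-≈ TLR _ k≡2 with refl ← k≡2 _ = rel₄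

ExceptionalOrder : ℕ → Set
ExceptionalOrder k = k ≡ 2 ⊎ (k > 2 × ¬ PrimePower k)

module _ {n} {M : Map n} where

  exceptional : ∀ d k → ExceptionalOrder k → IsoDM (DM d k) M → Exceptional M
  exceptional T k k-exc iso = inj₁ (k , k-exc , inj₂ (inj₁ iso))
  exceptional L k k-exc iso = inj₁ (k , k-exc , inj₁ iso)
  exceptional TL k k-exc iso = inj₁ (k , k-exc , inj₂ (inj₂ iso))
  exceptional R _ _ iso = inj₂ (inj₁ iso)
  exceptional TR _ _ iso = inj₂ (inj₂ (inj₁ iso))
  exceptional LR _ _ iso = inj₂ (inj₂ (inj₂ (inj₁ iso)))
  exceptional TLR _ _ iso = inj₂ (inj₂ (inj₂ (inj₂ iso)))

  exceptional-cases : Exceptional M →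
    ∃[ d ] ∃[ k ] (ExceptionalOrder k × (Klein d → k ≡ 2) × IsoDM (DM d k) M)
  exceptional-cases (inj₁ (k , k-exc , inj₁ iso)) = L , k , k-exc , (λ ()) , iso
  exceptional-cases (inj₁ (k , k-exc , inj₂ (inj₁ iso))) = T , k , k-exc , (λ ()) , iso
  exceptional-cases (inj₁ (k , k-exc , inj₂ (inj₂ iso))) = TL , k , k-exc , (λ ()) , iso
  exceptional-cases (inj₂ (inj₁ iso)) = R , 2 , inj₁ refl , (λ _ → refl) , iso
  exceptional-cases (inj₂ (inj₂ (inj₁ iso))) = TR , 2 , inj₁ refl , (λ _ → refl) , iso
  exceptional-cases (inj₂ (inj₂ (inj₂ (inj₁ iso)))) = LR , 2 , inj₁ refl , (λ _ → refl) , iso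
  exceptional-cases (inj₂ (inj₂ (inj₂ (inj₂ iso)))) = TLR , 2 , inj₁ refl , (λ _ → refl) , iso

spelling-genA : ∀ d → spelling d (genA d) ≡ [ A ]
spelling-genA T = refl
spelling-genA L = refl
spelling-genA R = refl
spelling-genA TL = refl
spelling-genA TR = refl
spelling-genA LR = refl
spelling-genA TLR = refl

spelling-genB : ∀ d → spelling d (genB d) ≡ [ B ]
spelling-genB T = refl
spelling-genB L = refl
spelling-genB R = refl
spelling-genB TL = refl
spelling-genB TR = refl
spelling-genB LR = refl
spelling-genB TLR = refl

module _ {n} (M : Map n) (regular : Regular M) {e : Exps} (a b : Gen) (k-1 : ℕ)
         (spelling : Gen → List AB) where
  open DihedralWords a b
  open Normalisation k-1 spelling

  dihedral-isoDM : RelatorsHold (monodromy M) e → (ρ ^ʷ k) ≈⟨ e ⟩ [] →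
    (∀ x → [ x ] ≈⟨ e ⟩ spell a b (spelling x)) →
    HasOrder (monodromy M) ρ k → (∀ {m} → m < k → ¬ [ a ] ≈[ M ] ρ ^ʷ m) → IsoDM e M
  dihedral-isoDM holds ρ^k≈ε spelled-e ρ-order a∉⟨ρ⟩ =
    (λ u v → mk⇔ (root-determines u v) (λ u≈v → ≈G (≈⟨⟩⇒∼ holds u≈v) (root M))) ,
    (λ w → mk⇔ (λ w≡ε → root-determines w [] (w≡ε (root M))) (≈G ∘ ≈⟨⟩⇒∼ holds))
    where
    module E = FCongruence (presented e)
    module G = FCongruence (monodromy M)
    normalise-e : ∀ w → w ≈⟨ e ⟩ ⌜ normalise w ⌝
    normalise-e = normalise-sound (presented e) ρ^k≈ε spelled-e
    normalise-M : ∀ w → w ≈[ M ] ⌜ normalise w ⌝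
    normalise-M = normalise-sound (monodromy M) (HasOrder.w^k∼ε ρ-order) (≈⟨⟩⇒∼ holds ∘ spelled-e)
    root-determines : ∀ u v → act (gen M) (root M) u ≡ act (gen M) (root M) v → u ≈⟨ e ⟩ v
    root-determines u v root·u≡root·v =
      E.∼-trans (normalise-e u) (E.∼-trans (E.≡⇒∼ (cong ⌜_⌝ nf-u≡nf-v)) (E.∼-sym (normalise-e v)))
      where
      nf-u≡nf-v : normalise u ≡ normalise v
      nf-u≡nf-v = Distinctness.⌜⌝-injective (monodromy M) k ρ-order a∉⟨ρ⟩
        (normalise-valid u) (normalise-valid v)
        (G.∼-trans (G.∼-sym (normalise-M u))
          (G.∼-trans (regular u v root·u≡root·v) (normalise-M v)))

module Classification {n} (M : Map n) (regular : Regular M) (d : Degeneracy)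
                      (d-trivial : Trivial M (trivialWord d)) (¬monolithic : ¬ Monolithic M) where
  open DihedralWords (genA d) (genB d)
  open FCongruence (monodromy M)

  spelled-M : ∀ x → [ x ] ≈[ M ] spell (genA d) (genB d) (spelling d x)
  spelled-M = spelled (monodromy M) d (mk≈ d-trivial)

  ¬≤2-elements : ∀ {y} → [ genA d ] ∼ [] ⊎ [ genA d ] ∼ [ y ] → ¬ ([ genB d ] ∼ [] ⊎ [ genB d ] ∼ [ y ])
  ¬≤2-elements a∈ b∈ =
    ¬monolithic (≤2-elements⇒monolithic M _ (≤2-elements (monodromy M) (spelling d) spelled-M a∈ b∈))

  ρ-order≥2 : ∃[ k-2 ] (HasOrder (monodromy M) ρ (suc (suc k-2)) ×
                      (∀ {m} → m < suc (suc k-2) → ¬ [ genA d ] ∼ ρ ^ʷ m))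
  ρ-order≥2 with order M regular ρ
  ... | suc (suc k-2) , _ , ρ-order =
    k-2 , ρ-order , Distinctness.a∉⟨ρ⟩ (monodromy M) _ ρ-order a≁ε b≁ε
    where
    a≁ε : ¬ [ genA d ] ∼ []
    a≁ε a∼ε = ¬≤2-elements (inj₁ a∼ε) (inj₂ ∼-refl)
    b≁ε : ¬ [ genB d ] ∼ []
    b≁ε b∼ε = ¬≤2-elements (inj₂ ∼-refl) (inj₁ b∼ε)
  ... | 1 , _ , ρ-order =
    contradiction (inj₂ (xy∼ε⇒y∼x (HasOrder.w^k∼ε ρ-order))) (¬≤2-elements (inj₂ ∼-refl))

  klein⇒k≡2 : ∀ {k-2} → HasOrder (monodromy M) ρ (suc (suc k-2)) → Klein d → suc (suc k-2) ≡ 2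
  klein⇒k≡2 {zero} _ _ = refl
  klein⇒k≡2 {suc _} ρ-order klein =
    contradiction (klein-ρ²∼ε (monodromy M) d klein) (HasOrder.minimal ρ-order z<s (s<s (s<s z<s)))

  isoDM : ∀ {k-2} (ρ-order : HasOrder (monodromy M) ρ (suc (suc k-2))) →
    (∀ {m} → m < suc (suc k-2) → ¬ [ genA d ] ∼ ρ ^ʷ m) → IsoDM (DM d (suc (suc k-2))) M
  isoDM {k-2} ρ-order a∉⟨ρ⟩ = dihedral-isoDM M regular (genA d) (genB d) (suc k-2) (spelling d)
    (relators-hold (monodromy M) d _ (mk≈ d-trivial) (HasOrder.w^k∼ε ρ-order))
    (ρ^k-≈ d _ (klein⇒k≡2 ρ-order)) (spelled (presented (DM d _)) d (trivialWord-≈ d _))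
    ρ-order a∉⟨ρ⟩

  exceptional-order : ∀ {k-2} → HasOrder (monodromy M) ρ (suc (suc k-2)) →
    ExceptionalOrder (suc (suc k-2))
  exceptional-order {zero} _ = inj₁ refl
  exceptional-order {suc k-3} ρ-order = inj₂ (s<s (s<s z<s) , ¬prime-power)
    where
    ¬prime-power : ¬ PrimePower (3 + k-3)
    ¬prime-power (p , zero , _ , ())
    ¬prime-power (p , suc m , p-prime , k≡p^[1+m]) = ¬monolithic
      (prime-power-order⇒monolithic M (genA d) (genB d) (2 + k-3) (spelling d) spelled-M
        ρ-order {p} {m} p-prime k≡p^[1+m] (s<s (s<s z<s)))

non-monolithic⇒exceptional : ∀ {n} (M : Map n) → Reflexible M → Degenerate M → ¬ Monolithic M →
  Exceptional M
non-monolithic⇒exceptional M reflexible degenerate ¬monolithic =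
  let d , d-trivial = degeneracy {M = M} degenerate
      open Classification M (reflexible⇒regular M reflexible) d d-trivial ¬monolithic
      _ , ρ-order , a∉⟨ρ⟩ = ρ-order≥2
  in exceptional {M = M} d _ (exceptional-order ρ-order) (isoDM ρ-order a∉⟨ρ⟩)

-- Quotients and parallel products

module _ {n} {M : Map n} {e : Exps} (M≅DM : IsoDM e M) where

  private
    module G = FCongruence (monodromy M)

    root· : Word → Fin n
    root· = act (gen M) (root M)

    word : Fin n → Word
    word z = proj₁ (transitive M z)

    root·word : ∀ z → root· (word z) ≡ z
    root·word z = proj₂ (transitive M z)

    root·≡⇒≈ : ∀ u v → root· u ≡ root· v → u ≈⟨ e ⟩ v
    root·≡⇒≈ u v = to (proj₁ M≅DM u v)

    root·-++ : ∀ z u → root· (word z ++ u) ≡ act (gen M) z u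
    root·-++ z u = trans (act-++ (gen M) (root M) (word z) u) (cong (λ y → act (gen M) y u) (root·word z))

  -- A regular map in which the relators of DM(e) hold is the quotient of M by its kernel.
  module Quotient {n₁} {M₁ : Map n₁} (sound : ∀ {u v} → u ≈⟨ e ⟩ v → u ≈[ M₁ ] v)
                  (regular : Regular M₁) where
    open FCongruence (monodromy M₁)

    π : Fin n → Fin n₁
    π z = act (gen M₁) (root M₁) (word z)

    π-root· : ∀ w → π (root· w) ≡ act (gen M₁) (root M₁) w
    π-root· w = ≈G (sound (root·≡⇒≈ (word (root· w)) w (root·word (root· w)))) (root M₁)

    kernel : NormalSubgroup M
    kernel = record
      { mem = _≈[ M₁ ] []
      ; resp = λ {u} {v} u≈v u≈ε → ∼-trans (∼-sym (sound (root·≡⇒≈ u v (u≈v (root M))))) u≈ε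
      ; has-id = ∼-refl
      ; closed-∙ = ++-cong
      ; closed-⁻¹ = λ {u} u≈ε → ∼-trans (∼-sym (++-congʳ (reverse u) u≈ε)) (reverse-inverseʳ u)
      ; normal = λ {u} u≈ε g → ∼-trans (++-congˡ (reverse g) (++-congʳ g u≈ε)) (reverse-inverseˡ g)
      }

    π≡⇒word⁻¹word≈ε : ∀ {z z'} → π z ≡ π z' → reverse (word z) ++ word z' ≈[ M₁ ] []
    π≡⇒word⁻¹word≈ε {z} {z'} πz≡πz' =
      ∼-trans (++-congˡ (reverse (word z)) (∼-sym (regular (word z) (word z') πz≡πz'))) (reverse-inverseˡ (word z))

    π-fibres : ∀ z z' → (π z ≡ π z') ⇔ (∃[ h ] (h ≈[ M₁ ] [] × act (gen M) z h ≡ z'))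
    π-fibres z z' = mk⇔ fibre⇒orbit orbit⇒fibre
      where
      u = word z
      v = word z'
      fibre⇒orbit : π z ≡ π z' → ∃[ h ] (h ≈[ M₁ ] [] × act (gen M) z h ≡ z')
      fibre⇒orbit πz≡πz' = reverse u ++ v ,
        π≡⇒word⁻¹word≈ε πz≡πz' ,
        (begin
          act (gen M) z (reverse u ++ v)   ≡⟨ root·-++ z (reverse u ++ v) ⟨
          root· (u ++ reverse u ++ v)      ≡⟨ ≈G uu⁻¹v≈v (root M) ⟩
          root· v                          ≡⟨ root·word z' ⟩
          z'                               ∎)
        where
        open ≡-Reasoning
        uu⁻¹v≈v : u ++ reverse u ++ v ≈[ M ] v
        uu⁻¹v≈v = G.∼-trans (G.≡⇒∼ (sym (++-assoc u (reverse u) v))) (G.++-congʳ v (G.reverse-inverseʳ u))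
      orbit⇒fibre : ∃[ h ] (h ≈[ M₁ ] [] × act (gen M) z h ≡ z') → π z ≡ π z'
      orbit⇒fibre (h , h≈ε , z·h≡z') = begin
        π z                                           ≡⟨ ≈G h≈ε (π z) ⟨
        act (gen M₁) (π z) h                          ≡⟨ act-++ (gen M₁) (root M₁) u h ⟨
        act (gen M₁) (root M₁) (u ++ h)               ≡⟨ ≈G (sound (root·≡⇒≈ (u ++ h) v root·uh≡root·v)) (root M₁) ⟩
        π z'                                          ∎
        where
        open ≡-Reasoning
        root·uh≡root·v : root· (u ++ h) ≡ root· v
        root·uh≡root·v = trans (root·-++ z h) (trans z·h≡z' (sym (root·word z')))

    π-equivariant : ∀ z x → π (gen M x z) ≡ gen M₁ x (π z)
    π-equivariant z x = begin
      π (gen M x z)                            ≡⟨ cong π (root·-++ z [ x ]) ⟨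
      π (root· (word z ++ [ x ]))              ≡⟨ π-root· (word z ++ [ x ]) ⟩
      act (gen M₁) (root M₁) (word z ++ [ x ]) ≡⟨ act-++ (gen M₁) (root M₁) (word z) [ x ] ⟩
      gen M₁ x (π z)                           ∎
      where open ≡-Reasoning

    isoQuot : IsoQuot M M₁ kernel
    isoQuot = π , π-root· [] , π-equivariant , π-fibres , π-surjective , λ _ → mk⇔ mk≈ ≈G
      where
      π-surjective : ∀ z₁ → ∃[ z ] π z ≡ z₁
      π-surjective z₁ = let w , root₁·w≡z₁ = transitive M₁ z₁ in root· w , trans (π-root· w) root₁·w≡z₁

  module _ {n₁ n₂} {M₁ : Map n₁} {M₂ : Map n₂}
           (sound₁ : ∀ {u v} → u ≈⟨ e ⟩ v → u ≈[ M₁ ] v) (regular₁ : Regular M₁)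
           (sound₂ : ∀ {u v} → u ≈⟨ e ⟩ v → u ≈[ M₂ ] v) (regular₂ : Regular M₂)
           (jointly-faithful : ∀ w → w ≈[ M₁ ] [] → w ≈[ M₂ ] [] → w ≈⟨ e ⟩ []) where
    private
      module Q₁ = Quotient sound₁ regular₁
      module Q₂ = Quotient sound₂ regular₂

    parallel : IsoPar M M₁ M₂
    parallel = φ , cong₂ _,_ (Q₁.π-root· []) (Q₂.π-root· []) , φ-equivariant , φ-injective ,
               (λ z → word z , refl) , φ-surjective , φ-kernel
      where
      φ : Fin n → Fin n₁ × Fin n₂
      φ z = Q₁.π z , Q₂.π z
      φ-equivariant : ∀ z x → φ (gen M x z) ≡ (gen M₁ x (Q₁.π z) , gen M₂ x (Q₂.π z))
      φ-equivariant z x = cong₂ _,_ (Q₁.π-equivariant z x) (Q₂.π-equivariant z x)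
      φ-injective : ∀ z z' → φ z ≡ φ z' → z ≡ z'
      φ-injective z z' φz≡φz' = begin
        z               ≡⟨ root·word z ⟨
        root· (word z)  ≡⟨ from (proj₁ M≅DM (word z) (word z')) u≈v ⟩
        root· (word z') ≡⟨ root·word z' ⟩
        z'              ∎
        where
        open ≡-Reasoning
        module E = FCongruence (presented e)
        u⁻¹v≈ε : (reverse (word z) ++ word z') ≈⟨ e ⟩ []
        u⁻¹v≈ε = jointly-faithful _ (Q₁.π≡⇒word⁻¹word≈ε (cong proj₁ φz≡φz'))
                                    (Q₂.π≡⇒word⁻¹word≈ε (cong proj₂ φz≡φz'))
        u≈v : word z ≈⟨ e ⟩ word z'
        u≈v = E.∼-sym (E.cancelˡ (reverse (word z)) (E.∼-trans u⁻¹v≈ε (E.∼-sym (E.reverse-inverseˡ (word z)))))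
      φ-surjective : ∀ w → ∃[ z ] φ z ≡ (act (gen M₁) (root M₁) w , act (gen M₂) (root M₂) w)
      φ-surjective w = root· w , cong₂ _,_ (Q₁.π-root· w) (Q₂.π-root· w)
      φ-kernel : ∀ w → Trivial M w ⇔ (Trivial M₁ w × Trivial M₂ w)
      φ-kernel w = mk⇔
        (λ w≡ε → let w≈ε = to (proj₂ M≅DM w) w≡ε in ≈G (sound₁ w≈ε) , ≈G (sound₂ w≈ε))
        (λ (w≡ε₁ , w≡ε₂) → from (proj₂ M≅DM w) (jointly-faithful w (mk≈ w≡ε₁) (mk≈ w≡ε₂)))

    decomposable : ∀ w₁ → w₁ ≈[ M₁ ] [] → ¬ w₁ ≈[ M₂ ] [] →
                   ∀ w₂ → w₂ ≈[ M₂ ] [] → ¬ w₂ ≈[ M₁ ] [] → Decomposable M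
    decomposable w₁ w₁≈ε₁ w₁≉ε₂ w₂ w₂≈ε₂ w₂≉ε₁ =
      n₁ , n₂ , M₁ , M₂ , (Q₁.kernel , Q₁.isoQuot) , (Q₂.kernel , Q₂.isoQuot) , parallel ,
      (λ M₁≅M₁∥M₂ → w₁≉ε₂ (mk≈ (proj₂ (to (parallel-kernel {M = M₁} {M₁} {M₂} M₁≅M₁∥M₂ w₁)
                                            (≈G w₁≈ε₁))))) ,
      (λ M₂≅M₁∥M₂ → w₂≉ε₁ (mk≈ (proj₁ (to (parallel-kernel {M = M₂} {M₁} {M₂} M₂≅M₁∥M₂ w₂)
                                            (≈G w₂≈ε₂)))))

-- Dihedral groups as maps

-- n ≡ -1 (mod 1+n)
n*[n*c]%[1+n]≡c%[1+n] : ∀ n c → n * (n * c) % suc n ≡ c % suc n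
n*[n*c]%[1+n]≡c%[1+n] zero c = trans (n%1≡0 0) (sym (n%1≡0 c))
n*[n*c]%[1+n]≡c%[1+n] (suc n) c =
  trans (cong (_% suc (suc n)) (expand n c)) ([m+kn]%n≡m%n c (n * c) (suc (suc n)))
  where
  expand : ∀ n c → suc n * (suc n * c) ≡ c + n * c * suc (suc n)
  expand = solve-∀

-- The dihedral group of order 2m: (s , c) is the rotation by c (mod m) followed,
-- if s, by a reflection.
module DihedralGroup (m-1 : ℕ) where

  m : ℕ
  m = suc m-1

  infix 4 _≡ₘ_ _≃_
  record _≡ₘ_ (c c' : ℕ) : Set where
    constructor mod-eq
    field mod≡ : c % m ≡ c' % m
  open _≡ₘ_ public

  ≡ₘ-refl : ∀ {c} → c ≡ₘ c
  ≡ₘ-refl = mod-eq refl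

  ≡ₘ-sym : ∀ {c c'} → c ≡ₘ c' → c' ≡ₘ c
  ≡ₘ-sym (mod-eq p) = mod-eq (sym p)

  ≡ₘ-trans : ∀ {c c' c''} → c ≡ₘ c' → c' ≡ₘ c'' → c ≡ₘ c''
  ≡ₘ-trans (mod-eq p) (mod-eq q) = mod-eq (trans p q)

  module ≡ₘ-Reasoning = SingleReasoning _≡ₘ_ ≡ₘ-refl ≡ₘ-trans

  ≡⇒≡ₘ : ∀ {c c'} → c ≡ c' → c ≡ₘ c'
  ≡⇒≡ₘ refl = ≡ₘ-refl

  +-cong-≡ₘ : ∀ {c₁ c₁' c₂ c₂'} → c₁ ≡ₘ c₁' → c₂ ≡ₘ c₂' → c₁ + c₂ ≡ₘ c₁' + c₂'
  +-cong-≡ₘ {c₁} {c₁'} {c₂} {c₂'} (mod-eq p) (mod-eq q) = mod-eq (begin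
    (c₁ + c₂) % m                 ≡⟨ %-distribˡ-+ c₁ c₂ m ⟩
    (c₁ % m + c₂ % m) % m         ≡⟨ cong₂ (λ x y → (x + y) % m) p q ⟩
    (c₁' % m + c₂' % m) % m       ≡⟨ %-distribˡ-+ c₁' c₂' m ⟨
    (c₁' + c₂') % m               ∎)
    where open ≡-Reasoning

  *-congˡ-≡ₘ : ∀ d {c c'} → c ≡ₘ c' → d * c ≡ₘ d * c'
  *-congˡ-≡ₘ d {c} {c'} (mod-eq p) = mod-eq (begin
    (d * c) % m                 ≡⟨ %-distribˡ-* d c m ⟩
    ((d % m) * (c % m)) % m     ≡⟨ cong (λ x → ((d % m) * x) % m) p ⟩
    ((d % m) * (c' % m)) % m    ≡⟨ %-distribˡ-* d c' m ⟨
    (d * c') % m                ∎)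
    where open ≡-Reasoning

  m-1*[m-1*c]≡ₘc : ∀ c → m-1 * (m-1 * c) ≡ₘ c
  m-1*[m-1*c]≡ₘc c = mod-eq (n*[n*c]%[1+n]≡c%[1+n] m-1 c)

  D : Set
  D = Bool × ℕ

  -- neg s c ≡ (-1)^s c (mod m)
  neg : Bool → ℕ → ℕ
  neg false c = c
  neg true c = m-1 * c

  infixl 7 _∙_
  _∙_ : D → D → D
  (s , c) ∙ (s' , c') = s xor s' , c + neg s c'

  ε : D
  ε = false , 0

  record _≃_ (x y : D) : Set where
    constructor _,_
    field
      reflection≡ : proj₁ x ≡ proj₁ y
      rotation≡ₘ  : proj₂ x ≡ₘ proj₂ y

  ≃-refl : ∀ {x} → x ≃ x
  ≃-refl = refl , ≡ₘ-refl

  ≃-sym : ∀ {x y} → x ≃ y → y ≃ x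
  ≃-sym (p , q) = sym p , ≡ₘ-sym q

  ≃-trans : ∀ {x y z} → x ≃ y → y ≃ z → x ≃ z
  ≃-trans (p , q) (p' , q') = trans p p' , ≡ₘ-trans q q'

  module ≃-Reasoning = SingleReasoning _≃_ ≃-refl ≃-trans

  ≡⇒≃ : ∀ {x y} → x ≡ y → x ≃ y
  ≡⇒≃ refl = ≃-refl

  reflection≄ε : ∀ {c} → ¬ (true , c) ≃ ε
  reflection≄ε (() , _)

  neg-+ : ∀ s c d → neg s (c + d) ≡ neg s c + neg s d
  neg-+ false c d = refl
  neg-+ true c d = *-distribˡ-+ m-1 c d

  neg-cong : ∀ s {c c'} → c ≡ₘ c' → neg s c ≡ₘ neg s c'
  neg-cong false p = p
  neg-cong true p = *-congˡ-≡ₘ m-1 p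

  neg-xor : ∀ s s' c → neg (s xor s') c ≡ₘ neg s (neg s' c)
  neg-xor false s' c = ≡ₘ-refl
  neg-xor true false c = ≡ₘ-refl
  neg-xor true true c = ≡ₘ-sym (m-1*[m-1*c]≡ₘc c)

  ∙-congˡ : ∀ {x x'} y → x ≃ x' → x ∙ y ≃ x' ∙ y
  ∙-congˡ {s , c} {.s , c'} (s' , d) (refl , c≡c') = refl , +-cong-≡ₘ c≡c' ≡ₘ-refl

  ∙-congʳ : ∀ x {y y'} → y ≃ y' → x ∙ y ≃ x ∙ y'
  ∙-congʳ (s , c) {s' , d} {.s' , d'} (refl , d≡d') = refl , +-cong-≡ₘ {c} ≡ₘ-refl (neg-cong s d≡d')

  ∙-assoc : ∀ x y z → x ∙ y ∙ z ≃ x ∙ (y ∙ z)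
  ∙-assoc (s , c) (s' , c') (s'' , c'') = xor-assoc s s' s'' , (begin
    c + neg s c' + neg (s xor s') c''        ≡⟨ +-assoc c (neg s c') _ ⟩
    c + (neg s c' + neg (s xor s') c'')      ∼⟨ +-cong-≡ₘ {c} ≡ₘ-refl
                                                  (+-cong-≡ₘ {neg s c'} ≡ₘ-refl (neg-xor s s' c'')) ⟩
    c + (neg s c' + neg s (neg s' c''))      ≡⟨ cong (c +_) (neg-+ s c' (neg s' c'')) ⟨
    c + neg s (c' + neg s' c'')              ∎)
    where open ≡ₘ-Reasoning

  ∙-identityʳ : ∀ x → x ∙ ε ≃ x
  ∙-identityʳ (false , c) = refl , ≡⇒≡ₘ (+-identityʳ c)
  ∙-identityʳ (true , c) = refl , ≡⇒≡ₘ (trans (cong (c +_) (*-zeroʳ m-1)) (+-identityʳ c))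

module DihedralAction (m-1 : ℕ) (σ : Gen → DihedralGroup.D m-1) where
  open DihedralGroup m-1

  infixl 6 _⊙_
  _⊙_ : D → Word → D
  x ⊙ w = foldl (λ y g → y ∙ σ g) x w

  ⟦_⟧ : Word → D
  ⟦ w ⟧ = ε ⊙ w

  ⊙-congˡ : ∀ {x y} w → x ≃ y → x ⊙ w ≃ y ⊙ w
  ⊙-congˡ [] x≃y = x≃y
  ⊙-congˡ (g ∷ w) x≃y = ⊙-congˡ w (∙-congˡ (σ g) x≃y)

  ⊙≃∙⟦⟧ : ∀ x w → x ⊙ w ≃ x ∙ ⟦ w ⟧
  ⊙≃∙⟦⟧ x [] = ≃-sym (∙-identityʳ x)
  ⊙≃∙⟦⟧ x (g ∷ w) = ≃-trans (⊙≃∙⟦⟧ (x ∙ σ g) w)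
    (≃-trans (∙-assoc x (σ g) ⟦ w ⟧) (∙-congʳ x (≃-sym (⊙≃∙⟦⟧ (σ g) w))))

  ⟦⟧-++ : ∀ u v → ⟦ u ++ v ⟧ ≃ ⟦ u ⟧ ∙ ⟦ v ⟧
  ⟦⟧-++ u v = subst (_≃ ⟦ u ⟧ ∙ ⟦ v ⟧) (sym (foldl-++ _ ε u v)) (⊙≃∙⟦⟧ ⟦ u ⟧ v)

  ⟦⟧-^ʷ : ∀ {w} c → ⟦ w ⟧ ≃ (false , 1) → ⟦ w ^ʷ c ⟧ ≃ (false , c)
  ⟦⟧-^ʷ zero _ = ≃-refl
  ⟦⟧-^ʷ {w} (suc c) ⟦w⟧≃ρ = ≃-trans (⟦⟧-++ w (w ^ʷ c))
    (≃-trans (∙-congˡ ⟦ w ^ʷ c ⟧ ⟦w⟧≃ρ) (∙-congʳ (false , 1) (⟦⟧-^ʷ c ⟦w⟧≃ρ)))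

  -- Flags: Fin (m + m), the first summand for rotations, the second for reflections.
  encode : D → Fin (m + m)
  encode (false , c) = join m m (inj₁ (c mod m))
  encode (true , c) = join m m (inj₂ (c mod m))

  decode : Fin (m + m) → D
  decode z = [ (λ i → false , toℕ i) , (λ i → true , toℕ i) ]′ (splitAt m z)

  toℕ-mod : ∀ c → toℕ (c mod m) ≡ c % m
  toℕ-mod c = Fin.toℕ-fromℕ< (m%n<n c m)

  mod-toℕ : ∀ (i : Fin m) → toℕ i mod m ≡ i
  mod-toℕ i = Fin.toℕ-injective (trans (toℕ-mod (toℕ i)) (m<n⇒m%n≡m (Fin.toℕ<n i)))

  encode-decode : ∀ z → encode (decode z) ≡ z
  encode-decode z = trans (encode-decode-⊎ (splitAt m z)) (Fin.join-splitAt m m z)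
    where
    encode-decode-⊎ : ∀ i → encode ([ (λ i → false , toℕ i) , (λ i → true , toℕ i) ]′ i) ≡ join m m i
    encode-decode-⊎ (inj₁ i) = cong (join m m ∘ inj₁) (mod-toℕ i)
    encode-decode-⊎ (inj₂ i) = cong (join m m ∘ inj₂) (mod-toℕ i)

  decode-encode : ∀ x → decode (encode x) ≃ x
  decode-encode (false , c) rewrite Fin.splitAt-join m m (inj₁ (c mod m)) =
    refl , mod-eq (trans (cong (_% m) (toℕ-mod c)) (m%n%n≡m%n c m))
  decode-encode (true , c) rewrite Fin.splitAt-join m m (inj₂ (c mod m)) =
    refl , mod-eq (trans (cong (_% m) (toℕ-mod c)) (m%n%n≡m%n c m))

  mod-cong : ∀ {c c'} → c ≡ₘ c' → c mod m ≡ c' mod m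
  mod-cong {c} {c'} (mod-eq c%m≡c'%m) = Fin.toℕ-injective (trans (toℕ-mod c) (trans c%m≡c'%m (sym (toℕ-mod c'))))

  encode-cong : ∀ {x y} → x ≃ y → encode x ≡ encode y
  encode-cong {false , _} (refl , c≡c') = cong (join m m ∘ inj₁) (mod-cong c≡c')
  encode-cong {true , _} (refl , c≡c') = cong (join m m ∘ inj₂) (mod-cong c≡c')

  encode-injective : ∀ {x y} → encode x ≡ encode y → x ≃ y
  encode-injective {x} {y} ex≡ey =
    ≃-trans (≃-sym (decode-encode x)) (subst (λ z → decode z ≃ y) (sym ex≡ey) (decode-encode y))

  generators : Gen → Fin (m + m) → Fin (m + m)
  generators g z = encode (decode z ∙ σ g)

  act-encode : ∀ z w → act generators z w ≡ encode (decode z ⊙ w)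
  act-encode z [] = sym (encode-decode z)
  act-encode z (g ∷ w) = trans (act-encode (generators g z) w)
    (encode-cong (⊙-congˡ w (decode-encode (decode z ∙ σ g))))

  act-⟦⟧ : ∀ z w → act generators z w ≡ encode (decode z ∙ ⟦ w ⟧)
  act-⟦⟧ z w = trans (act-encode z w) (encode-cong (⊙≃∙⟦⟧ (decode z) w))

  ≃⇒act≡ : ∀ u v → ⟦ u ⟧ ≃ ⟦ v ⟧ → ∀ z → act generators z u ≡ act generators z v
  ≃⇒act≡ u v ⟦u⟧≃⟦v⟧ z =
    trans (act-⟦⟧ z u) (trans (encode-cong (∙-congʳ (decode z) ⟦u⟧≃⟦v⟧)) (sym (act-⟦⟧ z v)))

  origin : Fin (m + m)
  origin = encode ε

  act-origin : ∀ w → act generators origin w ≡ encode ⟦ w ⟧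
  act-origin w = trans (act-encode origin w) (encode-cong (⊙-congˡ w (decode-encode ε)))

  module Realisation (σ-involutive : ∀ g → σ g ∙ σ g ≃ ε) (σ-[tl]² : σ t ∙ σ l ∙ σ t ∙ σ l ≃ ε)
           (rotation reflection : Word)
           (⟦rotation⟧ : ⟦ rotation ⟧ ≃ (false , 1)) (⟦reflection⟧ : ⟦ reflection ⟧ ≃ (true , 0)) where

    word-of : D → Word
    word-of (s , c) = (rotation ^ʷ c) ++ (if s then reflection else [])

    ⟦word-of⟧ : ∀ x → ⟦ word-of x ⟧ ≃ x
    ⟦word-of⟧ (s , c) = ≃-trans (⟦⟧-++ (rotation ^ʷ c) _)
      (≃-trans (∙-congˡ _ (⟦⟧-^ʷ c ⟦rotation⟧))
      (≃-trans (∙-congʳ (false , c) (⟦reflection-part⟧ s)) (refl , ≡⇒≡ₘ (+-identityʳ c))))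
      where
      ⟦reflection-part⟧ : ∀ s → ⟦ if s then reflection else [] ⟧ ≃ (s , 0)
      ⟦reflection-part⟧ false = ≃-refl
      ⟦reflection-part⟧ true = ⟦reflection⟧

    dihedralMap : Map (m + m)
    dihedralMap = record
      { gen = generators
      ; root = origin
      ; t² = ≃⇒act≡ (t ∷ t ∷ []) [] (σ-involutive t)
      ; l² = ≃⇒act≡ (l ∷ l ∷ []) [] (σ-involutive l)
      ; r² = ≃⇒act≡ (r ∷ r ∷ []) [] (σ-involutive r)
      ; tl² = ≃⇒act≡ (t ∷ l ∷ t ∷ l ∷ []) [] σ-[tl]²
      ; transitive = λ z → word-of (decode z) ,
          trans (act-origin (word-of (decode z))) (trans (encode-cong (⟦word-of⟧ (decode z))) (encode-decode z))
      }

    ≃⇒≈ : ∀ u v → ⟦ u ⟧ ≃ ⟦ v ⟧ → u ≈[ dihedralMap ] v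
    ≃⇒≈ u v ⟦u⟧≃⟦v⟧ = mk≈ (≃⇒act≡ u v ⟦u⟧≃⟦v⟧)

    ≈ε⇒≃ε : ∀ {w} → w ≈[ dihedralMap ] [] → ⟦ w ⟧ ≃ ε
    ≈ε⇒≃ε {w} w≈ε = encode-injective (trans (sym (act-origin w)) (≈G w≈ε origin))

    dihedralMap-regular : Regular dihedralMap
    dihedralMap-regular u v root·u≡root·v =
      ≃⇒≈ u v (encode-injective (trans (sym (act-origin u)) (trans root·u≡root·v (act-origin v))))

-- Decompositions

-- Realises a ↦ α, b ↦ β as a map on the flags of D_m, for each spelling of t, l, r.
module SpelledModel (m-1 : ℕ) (α β : DihedralGroup.D m-1) where
  open DihedralGroup m-1

  Exponent2 : Set
  Exponent2 = ∀ x → x ∙ x ≃ ε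

  image : AB → D
  image A = α
  image B = β

  evalAB : List AB → D
  evalAB [] = ε
  evalAB (x ∷ []) = image x
  evalAB (x ∷ y ∷ xs) = image x ∙ evalAB (y ∷ xs)

  σ : Degeneracy → Gen → D
  σ d x = evalAB (spelling d x)

  -- In the Klein cases the relations of F need D_m to have exponent 2 (r is spelled βα for TLR).
  module _ (α² : α ∙ α ≃ ε) (β² : β ∙ β ≃ ε) where

    σ-involutive : ∀ d → (Klein d → Exponent2) → ∀ x → σ d x ∙ σ d x ≃ ε
    σ-involutive T _ t = ≃-refl
    σ-involutive T _ l = α²
    σ-involutive T _ r = β²
    σ-involutive L _ t = α²
    σ-involutive L _ l = ≃-refl
    σ-involutive L _ r = β²
    σ-involutive TL _ t = α²
    σ-involutive TL _ l = α²
    σ-involutive TL _ r = β²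
    σ-involutive R exponent2 x = exponent2 tt (σ R x)
    σ-involutive TR exponent2 x = exponent2 tt (σ TR x)
    σ-involutive LR exponent2 x = exponent2 tt (σ LR x)
    σ-involutive TLR exponent2 x = exponent2 tt (σ TLR x)

    σ-[tl]² : ∀ d → (Klein d → Exponent2) → σ d t ∙ σ d l ∙ σ d t ∙ σ d l ≃ ε
    σ-[tl]² T _ = ≃-trans (∙-congˡ α (∙-identityʳ α)) α²
    σ-[tl]² L _ = ≃-trans (∙-identityʳ (α ∙ ε ∙ α)) (≃-trans (∙-congˡ α (∙-identityʳ α)) α²)
    σ-[tl]² TL _ = ≃-trans (∙-congˡ α (∙-congˡ α α²)) α²
    σ-[tl]² R exponent2 = ≃-trans (∙-assoc (α ∙ β) α β) (exponent2 tt (α ∙ β))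
    σ-[tl]² TR exponent2 = ≃-trans (∙-assoc (α ∙ β) α β) (exponent2 tt (α ∙ β))
    σ-[tl]² LR exponent2 = ≃-trans (∙-assoc (α ∙ β) α β) (exponent2 tt (α ∙ β))
    σ-[tl]² TLR exponent2 = ≃-trans (∙-assoc (α ∙ β) α β) (exponent2 tt (α ∙ β))

    ⟦trivialWord⟧ : ∀ d → let open DihedralAction m-1 (σ d) in ⟦ trivialWord d ⟧ ≃ ε
    ⟦trivialWord⟧ T = ≃-refl
    ⟦trivialWord⟧ L = ≃-refl
    ⟦trivialWord⟧ R = ≃-refl
    ⟦trivialWord⟧ TL = α²
    ⟦trivialWord⟧ TR = α²
    ⟦trivialWord⟧ LR = β²
    ⟦trivialWord⟧ TLR = begin
      α ∙ β ∙ (β ∙ α)     ∼⟨ ∙-assoc α β (β ∙ α) ⟩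
      α ∙ (β ∙ (β ∙ α))   ∼⟨ ∙-congʳ α (≃-sym (∙-assoc β β α)) ⟩
      α ∙ (β ∙ β ∙ α)     ∼⟨ ∙-congʳ α (∙-congˡ α β²) ⟩
      α ∙ α               ∼⟨ α² ⟩
      ε                   ∎
      where open ≃-Reasoning

    module SpelledMap (d : Degeneracy) (exponent2 : Klein d → Exponent2) where
      open DihedralAction m-1 (σ d) public
      open DihedralWords (genA d) (genB d) using (ρ)

      ⟦a⟧ : ⟦ [ genA d ] ⟧ ≡ α
      ⟦a⟧ = cong evalAB (spelling-genA d)

      ⟦b⟧ : ⟦ [ genB d ] ⟧ ≡ β
      ⟦b⟧ = cong evalAB (spelling-genB d)

      ⟦ρ⟧ : ⟦ ρ ⟧ ≡ α ∙ β
      ⟦ρ⟧ = cong₂ (λ x y → evalAB x ∙ evalAB y) (spelling-genA d) (spelling-genB d)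

      module QuotientMap (rotation reflection : Word)
               (⟦rotation⟧ : ⟦ rotation ⟧ ≃ (false , 1)) (⟦reflection⟧ : ⟦ reflection ⟧ ≃ (true , 0))
               (k : ℕ) (⟦ρ^k⟧ : ⟦ ρ ^ʷ k ⟧ ≃ ε) where

        open Realisation (σ-involutive d exponent2) (σ-[tl]² d exponent2)
                         rotation reflection ⟦rotation⟧ ⟦reflection⟧ public

        sound : ∀ {u v} → u ≈⟨ DM d k ⟩ v → u ≈[ dihedralMap ] v
        sound = ≈⟨⟩⇒∼ (relators-hold (monodromy dihedralMap) d k
          (≃⇒≈ (trivialWord d) [] (⟦trivialWord⟧ d)) (≃⇒≈ (ρ ^ʷ k) [] ⟦ρ^k⟧))

module _ (d : Degeneracy) (k-1 : ℕ) (klein : Klein d → suc k-1 ≡ 2) {n₁ n₂} {M₁ : Map n₁} {M₂ : Map n₂}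
         (sound₁ : ∀ {u v} → u ≈⟨ DM d (suc k-1) ⟩ v → u ≈[ M₁ ] v)
         (sound₂ : ∀ {u v} → u ≈⟨ DM d (suc k-1) ⟩ v → u ≈[ M₂ ] v) where
  open DihedralWords (genA d) (genB d)
  open Normalisation k-1 (spelling d)
  private
    module G₁ = FCongruence (monodromy M₁)
    module G₂ = FCongruence (monodromy M₂)

  normal-forms⇒jointly-faithful :
    (∀ {i s} → i < k → ⌜ i , s ⌝ ≈[ M₁ ] [] → ⌜ i , s ⌝ ≈[ M₂ ] [] → (i , s) ≡ (0 , false)) →
    ∀ w → w ≈[ M₁ ] [] → w ≈[ M₂ ] [] → w ≈⟨ DM d k ⟩ []
  normal-forms⇒jointly-faithful nf-faithful w w≈ε₁ w≈ε₂
    with normalise w | normalise-sound (presented (DM d k)) (ρ^k-≈ d k klein)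
                                       (spelled (presented (DM d k)) d (trivialWord-≈ d k)) w
       | normalise-valid w
  ... | i , s | w≈nf | i<k
    with refl ← nf-faithful i<k (G₁.∼-trans (G₁.∼-sym (sound₁ w≈nf)) w≈ε₁)
                                (G₂.∼-trans (G₂.∼-sym (sound₂ w≈nf)) w≈ε₂) = w≈nf

-- The factors are the quotients of the Klein four-group ⟨a, b⟩ by ⟨ρ⟩ and by ⟨b⟩.
klein-four-decomposable : ∀ d {n} {M : Map n} → IsoDM (DM d 2) M → Decomposable M
klein-four-decomposable d M≅DM =
  decomposable M≅DM M₁.sound M₁.dihedralMap-regular M₂.sound M₂.dihedralMap-regular
    (normal-forms⇒jointly-faithful d 1 (λ _ → refl) M₁.sound M₂.sound nf-faithful)
    ρ (M₁.≃⇒≈ ρ [] (≡⇒≃ A₁.⟦ρ⟧))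
      (λ ρ≈ε → reflection≄ε (subst (_≃ ε) A₂.⟦ρ⟧ (M₂.≈ε⇒≃ε ρ≈ε)))
    [ genB d ] (M₂.≃⇒≈ [ genB d ] [] (≡⇒≃ A₂.⟦b⟧))
      (λ b≈ε → reflection≄ε (subst (_≃ ε) A₁.⟦b⟧ (M₁.≈ε⇒≃ε b≈ε)))
  where
  open DihedralGroup 0
  open DihedralWords (genA d) (genB d) using (ρ; ⌜_⌝)

  flip : D
  flip = true , 0

  exponent2 : ∀ x → x ∙ x ≃ ε
  exponent2 (s , c) = xor-same s , mod-eq (n%1≡0 (c + neg s c))

  module A₁ = SpelledModel.SpelledMap 0 flip flip (exponent2 flip) (exponent2 flip) d (λ _ → exponent2)
  module A₂ = SpelledModel.SpelledMap 0 flip ε (exponent2 flip) ≃-refl d (λ _ → exponent2)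
  -- In D₁ the rotation (false , 1) is trivial, so the empty word reaches it.
  module M₁ = A₁.QuotientMap [] [ genA d ] (refl , mod-eq refl) (≡⇒≃ A₁.⟦a⟧) 2
    (≃-trans (A₁.⟦⟧-++ ρ ρ) (exponent2 A₁.⟦ ρ ⟧))
  module M₂ = A₂.QuotientMap [] [ genA d ] (refl , mod-eq refl) (≡⇒≃ A₂.⟦a⟧) 2
    (≃-trans (A₂.⟦⟧-++ ρ ρ) (exponent2 A₂.⟦ ρ ⟧))

  nf-faithful : ∀ {i s} → i < 2 → ⌜ i , s ⌝ ≈[ M₁.dihedralMap ] [] → ⌜ i , s ⌝ ≈[ M₂.dihedralMap ] [] →
                (i , s) ≡ (0 , false)
  nf-faithful {0} {false} _ _ _ = refl
  nf-faithful {0} {true} _ a≈ε _ = ⊥-elim (reflection≄ε (subst (_≃ ε) A₁.⟦a⟧ (M₁.≈ε⇒≃ε a≈ε)))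
  nf-faithful {1} {false} _ _ ρ≈ε = ⊥-elim (reflection≄ε (subst (_≃ ε) A₂.⟦ρ⟧ (M₂.≈ε⇒≃ε ρ≈ε)))
  nf-faithful {1} {true} _ ρa≈ε _ = ⊥-elim (reflection≄ε (subst (_≃ ε) (cong₂ _∙_ A₁.⟦ρ⟧ A₁.⟦a⟧)
    (≃-trans (≃-sym (A₁.⟦⟧-++ ρ [ genA d ])) (M₁.≈ε⇒≃ε ρa≈ε))))
  nf-faithful {suc (suc _)} (s≤s (s≤s ()))

-- The quotient D_m of D_k (m ∣ k): a ↦ reflection through the axis at 1, b ↦ reflection at 0.
module RotationQuotient (d : Degeneracy) (¬klein : ¬ Klein d) (k m-1 : ℕ) (m∣k : suc m-1 ∣ k) where
  open DihedralGroup m-1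
  open DihedralWords (genA d) (genB d) using (ρ; ⌜_⌝; reflection)

  α² : (true , 1) ∙ (true , 1) ≃ ε
  α² = refl , mod-eq (trans (cong (λ c → suc c % m) (*-identityʳ m-1)) (n%n≡0 m))

  β² : (true , 0) ∙ (true , 0) ≃ ε
  β² = refl , mod-eq (cong (_% m) (*-zeroʳ m-1))

  module A = SpelledModel.SpelledMap m-1 (true , 1) (true , 0) α² β² d (⊥-elim ∘ ¬klein)

  ⟦ρ⟧ : A.⟦ ρ ⟧ ≃ (false , 1)
  ⟦ρ⟧ = ≃-trans (≡⇒≃ A.⟦ρ⟧) (refl , ≡⇒≡ₘ (cong suc (*-zeroʳ m-1)))

  ⟦ρ^i⟧ : ∀ i → A.⟦ ρ ^ʷ i ⟧ ≃ (false , i)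
  ⟦ρ^i⟧ i = A.⟦⟧-^ʷ i ⟦ρ⟧

  open A.QuotientMap ρ [ genB d ] ⟦ρ⟧ (≡⇒≃ A.⟦b⟧) k
    (≃-trans (⟦ρ^i⟧ k) (refl , mod-eq (n∣m⇒m%n≡0 k m m∣k))) public

  m∣⇒ρ^i≈ε : ∀ {i} → m ∣ i → ρ ^ʷ i ≈[ dihedralMap ] []
  m∣⇒ρ^i≈ε {i} m∣i = ≃⇒≈ (ρ ^ʷ i) [] (≃-trans (⟦ρ^i⟧ i) (refl , mod-eq (n∣m⇒m%n≡0 i m m∣i)))

  ⌜⌝≈ε⇒ : ∀ {i s} → ⌜ i , s ⌝ ≈[ dihedralMap ] [] → s ≡ false × m ∣ i
  ⌜⌝≈ε⇒ {i} {s} nf≈ε with s | ≃-trans (≃-sym (A.⟦⟧-++ (ρ ^ʷ i) (reflection s))) (≈ε⇒≃ε nf≈ε)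
  ... | false | ρ^i∙ε≃ε = refl , m%n≡0⇒n∣m i m (mod≡ (_≃_.rotation≡ₘ i≃0))
    where
    i≃0 : (false , i) ≃ ε
    i≃0 = ≃-trans (≃-sym (⟦ρ^i⟧ i)) (≃-trans (≃-sym (∙-identityʳ _)) ρ^i∙ε≃ε)
  ... | true | ρ^i∙a≃ε = ⊥-elim (reflection≄ε (≃-trans (≃-sym ρ^i∙a≃i+1) ρ^i∙a≃ε))
    where
    ρ^i∙a≃i+1 : A.⟦ ρ ^ʷ i ⟧ ∙ A.⟦ [ genA d ] ⟧ ≃ (true , i + 1)
    ρ^i∙a≃i+1 = ≃-trans (∙-congˡ _ (⟦ρ^i⟧ i)) (∙-congʳ (false , i) (≡⇒≃ A.⟦a⟧))

  ρ^i≈ε⇒m∣i : ∀ {i} → ρ ^ʷ i ≈[ dihedralMap ] [] → m ∣ i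
  ρ^i≈ε⇒m∣i {i} ρ^i≈ε =
    proj₂ (⌜⌝≈ε⇒ {i} {false} (∼-trans (≡⇒∼ (++-identityʳ (ρ ^ʷ i))) ρ^i≈ε))
    where open FCongruence (monodromy dihedralMap)

-- The factors are the quotients D_{m₁} and D_{m₂} of D_k.
coprime-decomposable : ∀ d → ¬ Klein d → ∀ {k m₁ m₂} → 1 < m₁ → 1 < m₂ → Coprime m₁ m₂ →
  k ≡ m₁ * m₂ → ∀ {n} {M : Map n} → IsoDM (DM d k) M → Decomposable M
coprime-decomposable d ¬klein {suc k-1} {m₁@(suc m₁-1)} {m₂@(suc m₂-1)} 1<m₁ 1<m₂ m₁⊥m₂ k≡m₁m₂ M≅DM =
  decomposable M≅DM Q₁.sound Q₁.dihedralMap-regular Q₂.sound Q₂.dihedralMap-regular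
    (normal-forms⇒jointly-faithful d k-1 (⊥-elim ∘ ¬klein) Q₁.sound Q₂.sound nf-faithful)
    (ρ ^ʷ m₁) (Q₁.m∣⇒ρ^i≈ε ∣-refl)
      (coprime∧1<⇒∤ m₁⊥m₂ 1<m₂ ∘ Q₂.ρ^i≈ε⇒m∣i)
    (ρ ^ʷ m₂) (Q₂.m∣⇒ρ^i≈ε ∣-refl)
      (coprime∧1<⇒∤ (Coprimality.sym m₁⊥m₂) 1<m₁ ∘ Q₁.ρ^i≈ε⇒m∣i)
  where
  open DihedralWords (genA d) (genB d) using (ρ; ⌜_⌝)
  module Q₁ = RotationQuotient d ¬klein (suc k-1) m₁-1 (divides m₂ (trans k≡m₁m₂ (*-comm m₁ m₂)))
  module Q₂ = RotationQuotient d ¬klein (suc k-1) m₂-1 (divides m₁ k≡m₁m₂)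

  nf-faithful : ∀ {i s} → i < suc k-1 → ⌜ i , s ⌝ ≈[ Q₁.dihedralMap ] [] →
                ⌜ i , s ⌝ ≈[ Q₂.dihedralMap ] [] → (i , s) ≡ (0 , false)
  nf-faithful {i} {s} i<k nf≈ε₁ nf≈ε₂
    with Q₁.⌜⌝≈ε⇒ {i} {s} nf≈ε₁ | Q₂.⌜⌝≈ε⇒ {i} {s} nf≈ε₂
  ... | refl , m₁∣i | _ , m₂∣i
    with refl ← coprime∧∣∧∣∧<*⇒≡0 m₁⊥m₂ m₁∣i m₂∣i (subst (i <_) k≡m₁m₂ i<k) = refl

exceptional⇒decomposable : ∀ {n} (M : Map n) → Exceptional M → Decomposable M
exceptional⇒decomposable M exc with exceptional-cases {M = M} exc
... | d , .2 , inj₁ refl , _ , M≅DM = klein-four-decomposable d M≅DM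
... | d , k , inj₂ (2<k , ¬prime-power) , klein⇒k≡2 , M≅DM
  with m₁ , m₂ , 1<m₁ , 1<m₂ , m₁⊥m₂ , k≡m₁m₂ ← ¬primePower⇒coprime-split k 2<k ¬prime-power =
  coprime-decomposable d (λ klein → >⇒≢ 2<k (klein⇒k≡2 klein)) 1<m₁ 1<m₂ m₁⊥m₂ k≡m₁m₂ M≅DM

corollary18 : ∀ (n : ℕ) (M : Map n) → Reflexible M → Degenerate M →
    (Decomposable M ⇔ Exceptional M)
corollary18 n M reflexible degenerate = mk⇔
  (non-monolithic⇒exceptional M reflexible degenerate ∘ decomposable⇒¬monolithic M)
  (exceptional⇒decomposable M)
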